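{- Let $GQSym^{111}$ be the Hopf algebra with basis $(\mathbb{M}_G)$ described in the context. Let $GQSym^{011}$ be the span of the $\mathbb{M}_G$ such that the adjacency matrix of $G$ is symmetric, $GQSym^{101}$ the span of the $\mathbb{M}_G$ such that the adjacency matrix of $G$ has zero diagonal, and $GQSym^{001}:=GQSym^{011}\cap GQSym^{101}$. Then $GQSym^{011}$, $GQSym^{101}$ and $GQSym^{001}$ are Hopf subalgebras of $GQSym^{111}$.
   Context: $\mathbb{K}$ is a field of characteristic zero and $x_{ij}$ ($i,j\ge1$) commuting indeterminates. Graphs are labeled directed graphs with loops and multiple edges allowed, no isolated vertex, vertices numbered $1,\dots,m$; equivalently nonnegative integer matrices $A=(a_{ij})_{i,j=1}^m$ (adjacency matrices) with no index $i$ such that $a_{ij}=a_{ji}=0$ for all $j$. For such $G$, $\mathbb{M}_G:=\sum_{i_1<\dots<i_m}\prod_{j,k=1}^m x_{i_ji_k}^{a_{jk}}$, and $GQSym^{111}$ is the $\mathbb{K}$-span of the $\mathbb{M}_G$ inside formal power series in the $x_{ij}$, with the ordinary product, graded by the number of edges. An integer $i\in[0,m]$ is an admissible cut of $G$ if no edge joins a vertex of $[1,i]$ and a vertex of $[i+1,m]$; $C_G$ is the set of admissible cuts; $G|_D$ is the restriction of $G$ to $D\subseteq[1,m]$ with vertices renumbered $1,\dots,|D|$ in increasing order. The coproduct is $\Delta\mathbb{M}_G=\sum_{i\in C_G}\mathbb{M}_{G|_{[1,i]}}\otimes\mathbb{M}_{G|_{[i+1,m]}}$, making $GQSym^{111}$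 a graded Hopf algebra. -}

module Defs where

open import Level using (Level; _⊔_) renaming (suc to lsuc)
open import Algebra.Bundles using (CommutativeRing)
open import Data.Nat as ℕ using (ℕ; zero; suc; _∸_) renaming (_+_ to _+ℕ_)
open import Data.Nat.Properties using () renaming (_≟_ to _≟ℕ_)
open import Data.Fin as Fin using (Fin; toℕ; fromℕ<)
open import Data.Fin.Properties using (all?) renaming (_≟_ to _≟F_)
open import Data.List as List using (List; []; _∷_; map; concatMap; foldr; upTo; allFin; filterᵇ)
open import Data.Product using (Σ; ∃; _×_; _,_; proj₁; proj₂)
open import Data.Bool using (Bool; true; false; if_then_else_)
open import Data.List.Relation.Unary.All using (All)
open import Relation.Nullary using (¬_; Dec; yes; no; does)
open import Relation.Nullary.Decidable using (_→-dec_; _×-dec_)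
open import Relation.Binary.PropositionalEquality using (_≡_)

record Field (c ℓ : Level) : Set (lsuc (c ⊔ ℓ)) where
  field
    commutativeRing : CommutativeRing c ℓ
  open CommutativeRing commutativeRing public
  field
    0≉1     : ¬ (0# ≈ 1#)
    inverse : ∀ x → ¬ (x ≈ 0#) → Σ Carrier λ y → (x * y) ≈ 1#

allFuns : ∀ {a} {A : Set a} (k : ℕ) → (Fin k → List A) → List (Fin k → A)
allFuns zero    ch = (λ ()) ∷ []
allFuns (suc k) ch =
  concatMap (λ v → map (λ f → λ { Fin.zero → v ; (Fin.suc i) → f i })
                       (allFuns k (λ i → ch (Fin.suc i))))
            (ch Fin.zero)

-- a (labelled directed multi)graph on m vertices, via its adjacency matrix
Mat : ℕ → Set
Mat m = Fin m → Fin m → ℕ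

NoIsolated : ∀ {m} → Mat m → Set
NoIsolated {m} A = ∀ (i : Fin m) → ¬ (∀ (j : Fin m) → (A i j ≡ 0) × (A j i ≡ 0))

Symmetric : ∀ {m} → Mat m → Set
Symmetric {m} A = ∀ (i j : Fin m) → A i j ≡ A j i

ZeroDiagonal : ∀ {m} → Mat m → Set
ZeroDiagonal {m} A = ∀ (i : Fin m) → A i i ≡ 0

record Graph : Set where
  constructor graph
  field
    m      : ℕ
    adj    : Mat m
    noIso  : NoIsolated adj

sumℕ : List ℕ → ℕ
sumℕ = foldr _+ℕ_ 0

increasing? : ∀ {m n} → (Fin m → Fin n) → Bool
increasing? {m} φ = does (all? (λ j → all? (λ k → (j Fin.<? k) →-dec (φ j Fin.<? φ k))))

incMaps : (m n : ℕ) → List (Fin m → Fin n)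
incMaps m n = filterᵇ increasing? (allFuns m (λ _ → allFin n))

-- exponent matrix of the monomial  ∏_{j,k} x_{φ j, φ k}^{A j k}
push : ∀ {m n} → (Fin m → Fin n) → Mat m → Mat n
push {m} φ A p q =
  sumℕ (map (λ j → sumℕ (map (λ k →
     if does (φ j ≟F p) then (if does (φ k ≟F q) then A j k else 0) else 0)
     (allFin m))) (allFin m))

sameMat? : ∀ {n} → Mat n → Mat n → Bool
sameMat? e e' = does (all? (λ p → all? (λ q → e p q ≟ℕ e' p q)))

-- entry of a matrix at natural-number positions (0 outside the range)
entry : ∀ {m} → Mat m → ℕ → ℕ → ℕ
entry {m} A a b with a ℕ.<? m | b ℕ.<? m
... | yes a< | yes b< = A (fromℕ< a<) (fromℕ< b<)
... | _      | _      = 0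

-- G|_[1,i]  and  G|_[i+1,m]  (vertices renumbered increasingly)
restrictL : ∀ {m} (i : ℕ) → Mat m → Mat i
restrictL i A p q = entry A (toℕ p) (toℕ q)

restrictR : ∀ {m} (i : ℕ) → Mat m → Mat (m ∸ i)
restrictR i A p q = entry A (i +ℕ toℕ p) (i +ℕ toℕ q)

admissible? : ∀ {m} → Mat m → ℕ → Bool
admissible? {m} A i = does (all? (λ j → all? (λ k →
   (toℕ j ℕ.<? i) →-dec ((i ℕ.≤? toℕ k) →-dec ((A j k ≟ℕ 0) ×-dec (A k j ≟ℕ 0))))))

cuts : ∀ {m} → Mat m → List ℕ
cuts {m} A = filterᵇ (admissible? A) (upTo (suc m))

properCuts : ∀ {m} → Mat m → List ℕ
properCuts {m} A = filterᵇ (admissible? A) (upTo m)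

-- A monomial is represented as (n , e) with e : Fin n → Fin n → ℕ,
-- meaning ∏_{i,j ≤ n} x_{ij}^{e i j}  (Fin.zero ↦ index 1).

Mon : Set
Mon = Σ ℕ Mat

module GQSym {c ℓ} (F : Field c ℓ) where
  open Field F

  Series : Set c
  Series = Mon → Carrier

  _≈ₛ_ : Series → Series → Set ℓ
  f ≈ₛ g = ∀ μ → f μ ≈ g μ

  natK : ℕ → Carrier
  natK zero    = 0#
  natK (suc n) = 1# + natK n

  sumK : List Carrier → Carrier
  sumK = foldr _+_ 0#

  0ₛ : Series
  0ₛ _ = 0#

  _+ₛ_ : Series → Series → Series
  (f +ₛ g) μ = f μ + g μ

  _·ₛ_ : Carrier → Series → Series
  (a ·ₛ f) μ = a * f μ

  -ₛ_ : Series → Series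
  (-ₛ f) μ = - f μ

  sumₛ : List Series → Series
  sumₛ = foldr _+ₛ_ 0ₛ

  1ₛ : Series
  1ₛ (n , e) = if sameMat? e (λ _ _ → 0) then 1# else 0#

  _*ₛ_ : Series → Series → Series
  (f *ₛ g) (n , e) =
    sumK (map (λ e' → f (n , e') * g (n , (λ p q → e p q ∸ e' p q)))
              (allFuns n (λ p → allFuns n (λ q → upTo (suc (e p q))))))

  -- 𝕄_A = Σ_{i_1<...<i_m} ∏_{j,k} x_{i_j i_k}^{a_jk}
  𝕄 : ∀ {m} → Mat m → Series
  𝕄 {m} A (n , e) =
    sumK (map (λ φ → if sameMat? e (push φ A) then 1# else 0#) (incMaps m n))

  Comb : Set c
  Comb = List (Carrier × Graph)

  eval : Comb → Series
  eval r = sumₛ (map (λ cG → proj₁ cG ·ₛ 𝕄 (Graph.adj (proj₂ cG))) r)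

  Span : (P : ∀ {m} → Mat m → Set) → Series → Set (c ⊔ ℓ)
  Span P x = Σ Comb λ r → All (λ cG → P (Graph.adj (proj₂ cG))) r × (x ≈ₛ eval r)

  AnyGraph : ∀ {m} → Mat m → Set
  AnyGraph _ = Data.Unit.⊤
    where import Data.Unit

  GQSym111 GQSym011 GQSym101 GQSym001 : Series → Set (c ⊔ ℓ)
  GQSym111 = Span (λ _ → Data.Unit.⊤) where import Data.Unit
  GQSym011 = Span Symmetric
  GQSym101 = Span ZeroDiagonal
  GQSym001 x = GQSym011 x × GQSym101 x

  -- tensor square, realised inside series in two sets of variables
  TSeries : Set c
  TSeries = Mon → Mon → Carrier

  _≈ₜ_ : TSeries → TSeries → Set ℓ
  s ≈ₜ t = ∀ μ ν → s μ ν ≈ t μ ν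

  _⊗_ : Series → Series → TSeries
  (f ⊗ g) μ ν = f μ * g ν

  0ₜ : TSeries
  0ₜ _ _ = 0#

  _+ₜ_ : TSeries → TSeries → TSeries
  (s +ₜ t) μ ν = s μ ν + t μ ν

  sumₜ : List TSeries → TSeries
  sumₜ = foldr _+ₜ_ 0ₜ

  TensorSq : (Series → Set (c ⊔ ℓ)) → TSeries → Set (c ⊔ ℓ)
  TensorSq V t =
    Σ (List (Carrier × Σ Series V × Σ Series V)) λ l →
      t ≈ₜ sumₜ (map (λ { (a , (x , _) , (y , _)) μ ν → a * (x ⊗ y) μ ν }) l)

  Δ𝕄 : ∀ {m} → Mat m → TSeries
  Δ𝕄 A = sumₜ (map (λ i → 𝕄 (restrictL i A) ⊗ 𝕄 (restrictR i A)) (cuts A))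

  Δ : Comb → TSeries
  Δ r = sumₜ (map (λ cG μ ν → proj₁ cG * Δ𝕄 (Graph.adj (proj₂ cG)) μ ν) r)

  -- antipode of the connected graded bialgebra, by the defining recursion
  --   S(1) = 1,   S(𝕄_G) = - Σ_{i ∈ C_G, i < m} S(𝕄_{G|[1,i]}) 𝕄_{G|[i+1,m]}
  -- (fuel argument ≥ m+1)
  S𝕄′ : ℕ → ∀ {m} → Mat m → Series
  S𝕄′ zero              A = 1ₛ
  S𝕄′ (suc f) {zero}    A = 1ₛ
  S𝕄′ (suc f) {suc m}   A =
    -ₛ sumₛ (map (λ i → S𝕄′ f (restrictL i A) *ₛ 𝕄 (restrictR i A)) (properCuts A))

  S𝕄 : ∀ {m} → Mat m → Series
  S𝕄 {m} A = S𝕄′ (suc m) A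

  S : Comb → Series
  S r = sumₛ (map (λ cG → proj₁ cG ·ₛ S𝕄 (Graph.adj (proj₂ cG))) r)

  record IsHopfSubalgebra (V : Series → Set (c ⊔ ℓ)) : Set (c ⊔ ℓ) where
    field
      sub      : ∀ x → V x → GQSym111 x
      resp     : ∀ x y → x ≈ₛ y → V x → V y
      zero∈    : V 0ₛ
      +-closed : ∀ x y → V x → V y → V (x +ₛ y)
      ·-closed : ∀ a x → V x → V (a ·ₛ x)
      one∈     : V 1ₛ
      *-closed : ∀ x y → V x → V y → V (x *ₛ y)
      Δ-closed : ∀ x (r : Comb) → x ≈ₛ eval r → V x → TensorSq V (Δ r)
      S-closed : ∀ x (r : Comb) → x ≈ₛ eval r → V x → V (S r)

CharZero : ∀ {c ℓ} → Field c ℓ → Set ℓ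
CharZero F = ∀ n → ¬ (natK (suc n) ≈ 0#)
  where open Field F
        open GQSym F using (natK)

module Submission where

-- A pair of increasing index maps φ, ψ placing graphs A and B into the variables factors uniquely as
-- χ ∘ σ, χ ∘ τ with (σ, τ) a quasi-shuffle and χ the increasing enumeration of the union of the images.
-- Hence 𝕄_A 𝕄_B is the sum of 𝕄 of the overlays of A and B along the quasi-shuffles.  Overlaying keeps
-- adjacency matrices symmetric, and keeps a zero diagonal because σ and τ are injective; restricting to
-- the blocks between admissible cuts keeps both properties.  So each span is closed under products, and
-- the coproduct and the recursively defined antipode of one of its basis elements stay inside it.
-- Finally 𝕄_G is the only basis element containing the monomial x^G, so the coefficients of any
-- representation of an element of the span vanish outside the class, and Δ and S applied to any
-- representation land in the span.

open import Level using (_⊔_)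
open import Algebra.Bundles using (CommutativeSemiring)
open import Data.Bool using (Bool; true; false; if_then_else_; _∧_; not; T)
open import Data.Empty using (⊥; ⊥-elim)
open import Data.Fin as Fin using (Fin; toℕ; fromℕ<; _↑ˡ_; _↑ʳ_)
open import Data.Fin.Properties as Finₚ using (all?; any?; toℕ-injective; toℕ-fromℕ<; toℕ<n) renaming (_≟_ to _≟F_)
open import Data.List using (List; []; _∷_; _++_; map; foldr; filter; filterᵇ; concatMap; allFin; upTo; length)
open import Data.List.Properties using (map-tabulate; map-applyUpTo; length-filter; filter-reject; filter-≐)
open import Data.List.Membership.Propositional using (_∈_; mapWith∈)
open import Data.List.Membership.Propositional.Properties using (∈-allFin; ∈-upTo⁻; ∈-filter⁻)
open import Data.List.Relation.Unary.All as All using (All; []; _∷_)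
import Data.List.Relation.Unary.All.Properties as All
open import Data.List.Relation.Unary.Any using (here; there)
open import Data.Nat as ℕ using (ℕ; zero; suc; _∸_; _≤_; _<_; z≤n; s≤s)
open import Data.Nat.Properties as ℕₚ using (+-*-commutativeSemiring) renaming (_≟_ to _≟ℕ_)
open import Data.Product using (Σ; ∃; _×_; _,_; proj₁; proj₂)
open import Data.Sum using (_⊎_; inj₁; inj₂; [_,_]′)
open import Data.Unit using (tt)
open import Relation.Binary using (tri<; tri≈; tri>)
open import Relation.Binary.PropositionalEquality as ≡ using (_≡_; _≢_; cong; cong₂; subst; subst₂)
open import Relation.Nullary using (¬_; Dec; yes; no; does; ¬?; T?)
open import Relation.Nullary.Decidable as Dec using (_×-dec_; _⊎-dec_; _→-dec_; dec-true; dec-false; does-⇔)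
open import Function.Bundles using (mk⇔)

open import Defs

-- Finite sums and Iverson brackets

pointwise? : ∀ {a r} {A : Set a} {R : A → A → Set r} → (∀ x y → Dec (R x y)) →
             ∀ {k} (f g : Fin k → A) → Dec (∀ i → R (f i) (g i))
pointwise? R? f g = all? (λ i → R? (f i) (g i))

allᵇ : ∀ {a} {A : Set a} k → (Fin k → A → Bool) → (Fin k → A) → Bool
allᵇ zero    s g = true
allᵇ (suc k) s g = s Fin.zero (g Fin.zero) ∧ allᵇ k (λ i → s (Fin.suc i)) (λ i → g (Fin.suc i))

allᵇ-const : ∀ {a} {A : Set a} k (g : Fin k → A) → allᵇ k (λ _ _ → true) g ≡ true
allᵇ-const zero    g = ≡.refl
allᵇ-const (suc k) g = allᵇ-const k (λ i → g (Fin.suc i))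

∧-≡-true : ∀ {a b} → a ∧ b ≡ true → a ≡ true × b ≡ true
∧-≡-true {true} b≡true = ≡.refl , b≡true

≡-true-∧ : ∀ {a b} → a ≡ true → b ≡ true → a ∧ b ≡ true
≡-true-∧ ≡.refl b≡true = b≡true

bool-ext : ∀ {a b : Bool} → (a ≡ true → b ≡ true) → (b ≡ true → a ≡ true) → a ≡ b
bool-ext {true}  {true}  _ _ = ≡.refl
bool-ext {true}  {false} f _ = ≡.sym (f ≡.refl)
bool-ext {false} {true}  _ g = g ≡.refl
bool-ext {false} {false} _ _ = ≡.refl

allᵇ⇒ : ∀ {a} {A : Set a} k {s : Fin k → A → Bool} {g : Fin k → A} → allᵇ k s g ≡ true → ∀ i → s i (g i) ≡ true
allᵇ⇒ (suc k) t Fin.zero    = proj₁ (∧-≡-true t)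
allᵇ⇒ (suc k) t (Fin.suc i) = allᵇ⇒ k (proj₂ (∧-≡-true t)) i

⇒allᵇ : ∀ {a} {A : Set a} k {s : Fin k → A → Bool} {g : Fin k → A} → (∀ i → s i (g i) ≡ true) → allᵇ k s g ≡ true
⇒allᵇ zero    _ = ≡.refl
⇒allᵇ (suc k) t = ≡-true-∧ (t Fin.zero) (⇒allᵇ k (λ i → t (Fin.suc i)))

module FiniteSum {c ℓ} (R : CommutativeSemiring c ℓ) where
  open CommutativeSemiring R
  open import Relation.Binary.Reasoning.Setoid setoid

  ∑ : ∀ {a} {A : Set a} → List A → (A → Carrier) → Carrier
  ∑ l f = foldr _+_ 0# (map f l)

  module _ {a} {A : Set a} where

    ∑-cong : ∀ (l : List A) {f g : A → Carrier} → (∀ x → f x ≈ g x) → ∑ l f ≈ ∑ l g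
    ∑-cong []      f≈g = refl
    ∑-cong (x ∷ l) f≈g = +-cong (f≈g x) (∑-cong l f≈g)

    ∑-zero : ∀ (l : List A) {f : A → Carrier} → (∀ x → f x ≈ 0#) → ∑ l f ≈ 0#
    ∑-zero []      f≈0 = refl
    ∑-zero (x ∷ l) f≈0 = trans (+-cong (f≈0 x) (∑-zero l f≈0)) (+-identityˡ _)

    ∑-++ : ∀ (l l′ : List A) (f : A → Carrier) → ∑ (l ++ l′) f ≈ ∑ l f + ∑ l′ f
    ∑-++ []      l′ f = sym (+-identityˡ _)
    ∑-++ (x ∷ l) l′ f = trans (+-congˡ (∑-++ l l′ f)) (sym (+-assoc _ _ _))

    ∑-+ : ∀ (l : List A) (f g : A → Carrier) → ∑ l (λ x → f x + g x) ≈ ∑ l f + ∑ l g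
    ∑-+ []      f g = sym (+-identityˡ _)
    ∑-+ (x ∷ l) f g = begin
      (f x + g x) + ∑ l (λ x → f x + g x) ≈⟨ +-congˡ (∑-+ l f g) ⟩
      (f x + g x) + (∑ l f + ∑ l g)       ≈⟨ +-assoc _ _ _ ⟩
      f x + (g x + (∑ l f + ∑ l g))       ≈⟨ +-congˡ (sym (+-assoc _ _ _)) ⟩
      f x + ((g x + ∑ l f) + ∑ l g)       ≈⟨ +-congˡ (+-congʳ (+-comm _ _)) ⟩
      f x + ((∑ l f + g x) + ∑ l g)       ≈⟨ +-congˡ (+-assoc _ _ _) ⟩
      f x + (∑ l f + (g x + ∑ l g))       ≈⟨ sym (+-assoc _ _ _) ⟩
      (f x + ∑ l f) + (g x + ∑ l g)       ∎

    *-distribˡ-∑ : ∀ k (l : List A) (f : A → Carrier) → k * ∑ l f ≈ ∑ l (λ x → k * f x)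
    *-distribˡ-∑ k []      f = zeroʳ k
    *-distribˡ-∑ k (x ∷ l) f = trans (distribˡ k _ _) (+-congˡ (*-distribˡ-∑ k l f))

    *-distribʳ-∑ : ∀ k (l : List A) (f : A → Carrier) → ∑ l f * k ≈ ∑ l (λ x → f x * k)
    *-distribʳ-∑ k l f = trans (*-comm _ _) (trans (*-distribˡ-∑ k l f) (∑-cong l (λ _ → *-comm _ _)))

  ∑-map : ∀ {a b} {A : Set a} {B : Set b} (l : List A) (g : A → B) (f : B → Carrier) → ∑ (map g l) f ≈ ∑ l (λ x → f (g x))
  ∑-map []      g f = refl
  ∑-map (x ∷ l) g f = +-congˡ (∑-map l g f)

  ∑-concatMap : ∀ {a b} {A : Set a} {B : Set b} (l : List A) (g : A → List B) (f : B → Carrier) →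
                ∑ (concatMap g l) f ≈ ∑ l (λ x → ∑ (g x) f)
  ∑-concatMap []      g f = refl
  ∑-concatMap (x ∷ l) g f = trans (∑-++ (g x) (concatMap g l) f) (+-congˡ (∑-concatMap l g f))

  ∑-comm : ∀ {a b} {A : Set a} {B : Set b} (l : List A) (l′ : List B) (f : A → B → Carrier) →
           ∑ l (λ x → ∑ l′ (f x)) ≈ ∑ l′ (λ y → ∑ l (λ x → f x y))
  ∑-comm []      l′ f = sym (∑-zero l′ (λ _ → refl))
  ∑-comm (x ∷ l) l′ f = trans (+-congˡ (∑-comm l l′ f)) (sym (∑-+ l′ (f x) _))

  ∑-mapWith∈ : ∀ {a b} {A : Set a} {B : Set b} (l : List A) (g : ∀ {x} → x ∈ l → B) (f : B → Carrier) (f′ : A → Carrier) →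
               (∀ {x} (x∈l : x ∈ l) → f (g x∈l) ≈ f′ x) → ∑ (mapWith∈ l g) f ≈ ∑ l f′
  ∑-mapWith∈ []      g f f′ f≈ = refl
  ∑-mapWith∈ (x ∷ l) g f f′ f≈ = +-cong (f≈ (here ≡.refl)) (∑-mapWith∈ l (λ x∈l → g (there x∈l)) f f′ (λ x∈l → f≈ (there x∈l)))

  -- Iverson bracket, kept opaque so that it is only manipulated through the lemmas below.
  opaque
    [_]_ : Bool → Carrier → Carrier
    [ b ] x = if b then x else 0#

    []-unfold : ∀ b x → [ b ] x ≈ (if b then x else 0#)
    []-unfold b x = refl

    []-true : ∀ {b} x → b ≡ true → [ b ] x ≈ x
    []-true x ≡.refl = refl

    []-false : ∀ {b} x → b ≡ false → [ b ] x ≈ 0#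
    []-false x ≡.refl = refl

    []-cong : ∀ b {x y} → x ≈ y → [ b ] x ≈ [ b ] y
    []-cong true  x≈y = x≈y
    []-cong false x≈y = refl

    []-congᵗ : ∀ b {x y} → (b ≡ true → x ≈ y) → [ b ] x ≈ [ b ] y
    []-congᵗ true  x≈y = x≈y ≡.refl
    []-congᵗ false x≈y = refl

    []-∧ : ∀ b b′ x → [ b ∧ b′ ] x ≈ [ b ] [ b′ ] x
    []-∧ true  b′ x = refl
    []-∧ false b′ x = refl

    []-comm : ∀ b b′ x → [ b ] [ b′ ] x ≈ [ b′ ] [ b ] x
    []-comm true  b′    x = refl
    []-comm false true  x = refl
    []-comm false false x = refl

    []-0 : ∀ b → [ b ] 0# ≈ 0#
    []-0 true  = refl
    []-0 false = refl

    []-+ : ∀ b x y → [ b ] (x + y) ≈ [ b ] x + [ b ] y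
    []-+ true  x y = refl
    []-+ false x y = sym (+-identityˡ _)

    []-*ˡ : ∀ b x y → ([ b ] x) * y ≈ [ b ] (x * y)
    []-*ˡ true  x y = refl
    []-*ˡ false x y = zeroˡ y

    []-*ʳ : ∀ b x y → x * ([ b ] y) ≈ [ b ] (x * y)
    []-*ʳ true  x y = refl
    []-*ʳ false x y = zeroʳ x

    []-split : ∀ b x → x ≈ [ b ] x + [ not b ] x
    []-split true  x = sym (+-identityʳ x)
    []-split false x = sym (+-identityˡ x)

    ∑-[] : ∀ {a} {A : Set a} b (l : List A) (f : A → Carrier) → ∑ l (λ x → [ b ] f x) ≈ [ b ] ∑ l f
    ∑-[] true  l f = refl
    ∑-[] false l f = ∑-zero l (λ _ → refl)

    ∑-filter : ∀ {a p} {A : Set a} {P : A → Set p} (P? : ∀ x → Dec (P x)) (l : List A) (f : A → Carrier) →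
               ∑ (filter P? l) f ≈ ∑ l (λ x → [ does (P? x) ] f x)
    ∑-filter P? []      f = refl
    ∑-filter P? (x ∷ l) f with does (P? x)
    ... | true  = +-congˡ (∑-filter P? l f)
    ... | false = trans (∑-filter P? l f) (sym (+-identityˡ _))

  []-congᵇ : ∀ {b b′} x → b ≡ b′ → [ b ] x ≈ [ b′ ] x
  []-congᵇ x ≡.refl = refl

  []-*1 : ∀ b x → x * ([ b ] 1#) ≈ [ b ] x
  []-*1 b x = trans ([]-*ʳ b x 1#) ([]-cong b (*-identityʳ x))

  -- l lists, exactly once up to R, the elements g with s g.
  Enumerates : ∀ {a r} {A : Set a} {R : A → A → Set r} → List A → (∀ x y → Dec (R x y)) → (A → Bool) → Set _
  Enumerates {A = A} {R} l R? s = ∀ g (h : A → Carrier) → (∀ a → R a g → h a ≈ h g) →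
    ∑ l (λ a → [ does (R? a g) ] h a) ≈ [ s g ] h g

  private
    ∑-allFin-suc : ∀ n (f : Fin (suc n) → Carrier) → ∑ (allFin (suc n)) f ≈ f Fin.zero + ∑ (allFin n) (λ i → f (Fin.suc i))
    ∑-allFin-suc n f = +-congˡ (reflexive (cong (foldr _+_ 0#)
      (≡.trans (map-tabulate Fin.suc f) (≡.sym (map-tabulate (λ i → i) (λ i → f (Fin.suc i)))))))

    ∑-upTo-suc : ∀ n (f : ℕ → Carrier) → ∑ (upTo (suc n)) f ≈ f 0 + ∑ (upTo n) (λ i → f (suc i))
    ∑-upTo-suc n f = +-congˡ (reflexive (cong (foldr _+_ 0#)
      (≡.trans (map-applyUpTo suc f n) (≡.sym (map-applyUpTo (λ i → i) (λ i → f (suc i)) n)))))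

  allFin-enumerates : ∀ n → Enumerates (allFin n) (_≟F_ {n}) (λ _ → true)
  allFin-enumerates (suc n) Fin.zero h _ = begin
    ∑ (allFin (suc n)) _                   ≈⟨ ∑-allFin-suc n _ ⟩
    [ true ] h Fin.zero + ∑ (allFin n) _   ≈⟨ +-congˡ (∑-zero (allFin n) (λ _ → []-false _ ≡.refl)) ⟩
    [ true ] h Fin.zero + 0#               ≈⟨ +-identityʳ _ ⟩
    [ true ] h Fin.zero                    ∎
  allFin-enumerates (suc n) (Fin.suc g) h _ = begin
    ∑ (allFin (suc n)) _                   ≈⟨ ∑-allFin-suc n _ ⟩
    [ false ] h Fin.zero + ∑ (allFin n) _  ≈⟨ +-congʳ ([]-false _ ≡.refl) ⟩
    0# + ∑ (allFin n) _                    ≈⟨ +-identityˡ _ ⟩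
    ∑ (allFin n) _                         ≈⟨ allFin-enumerates n g (λ i → h (Fin.suc i)) (λ { _ ≡.refl → refl }) ⟩
    [ true ] h (Fin.suc g)                 ∎

  upTo-enumerates : ∀ n → Enumerates (upTo (suc n)) _≟ℕ_ (λ g → does (g ℕ.≤? n))
  upTo-enumerates zero    zero    h _ = +-identityʳ _
  upTo-enumerates zero    (suc g) h _ = trans (+-identityʳ _) (trans ([]-false _ ≡.refl) (sym ([]-false _ ≡.refl)))
  upTo-enumerates (suc n) zero    h _ = begin
    ∑ (upTo (suc (suc n))) _     ≈⟨ ∑-upTo-suc (suc n) _ ⟩
    [ true ] h 0 + ∑ (upTo (suc n)) _ ≈⟨ +-congˡ (∑-zero (upTo (suc n)) (λ _ → []-false _ ≡.refl)) ⟩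
    [ true ] h 0 + 0#            ≈⟨ +-identityʳ _ ⟩
    [ true ] h 0                 ∎
  upTo-enumerates (suc n) (suc g) h _ = begin
    ∑ (upTo (suc (suc n))) _            ≈⟨ ∑-upTo-suc (suc n) _ ⟩
    [ false ] h 0 + ∑ (upTo (suc n)) _  ≈⟨ +-congʳ ([]-false _ ≡.refl) ⟩
    0# + ∑ (upTo (suc n)) _             ≈⟨ +-identityˡ _ ⟩
    ∑ (upTo (suc n)) _                  ≈⟨ upTo-enumerates n g (λ i → h (suc i)) (λ { _ ≡.refl → refl }) ⟩
    [ does (g ℕ.≤? n) ] h (suc g)       ≈⟨ []-congᵇ _ (does-⇔ (mk⇔ s≤s ℕₚ.≤-pred) (g ℕ.≤? n) (suc g ℕ.≤? suc n)) ⟩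
    [ does (suc g ℕ.≤? suc n) ] h (suc g) ∎

  module _ {a r} {A : Set a} {R : A → A → Set r} (R-refl : ∀ x → R x x) (R? : ∀ x y → Dec (R x y)) where

    -- Stated for an arbitrary cons: the one in allFuns is an anonymous pattern lambda.
    private
      ∑-cons : ∀ k (ch : Fin (suc k) → List A) (s : Fin (suc k) → A → Bool) (g : Fin (suc k) → A) (h : (Fin (suc k) → A) → Carrier) →
        (cons : A → (Fin k → A) → Fin (suc k) → A) → (∀ v f → cons v f Fin.zero ≡ v) → (∀ v f i → cons v f (Fin.suc i) ≡ f i) →
        (∀ i → Enumerates (ch i) R? (s i)) → (∀ f → (∀ i → R (f i) (g i)) → h f ≈ h g) →
        Enumerates (allFuns k (λ i → ch (Fin.suc i))) (pointwise? R?) (allᵇ k (λ i → s (Fin.suc i))) →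
        ∑ (ch Fin.zero) (λ v → ∑ (allFuns k (λ i → ch (Fin.suc i))) (λ f → [ does (pointwise? R? (cons v f) g) ] h (cons v f)))
          ≈ [ allᵇ (suc k) s g ] h g
      ∑-cons k ch s g h cons cons-zero cons-suc ch-enum h-resp tail-enum = begin
        ∑ (ch Fin.zero) (λ v → ∑ rest (λ f → [ does (pointwise? R? (cons v f) g) ] h (cons v f)))
          ≈⟨ ∑-cong (ch Fin.zero) inner ⟩
        ∑ (ch Fin.zero) (λ v → [ does (R? v g₀) ] H v)
          ≈⟨ ch-enum Fin.zero g₀ H H-resp ⟩
        [ s Fin.zero g₀ ] H g₀
          ≈⟨ []-cong (s Fin.zero g₀) ([]-cong (allᵇ k s′ g′) (h-resp _ (cons-R (R-refl g₀) (λ i → R-refl (g′ i))))) ⟩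
        [ s Fin.zero g₀ ] [ allᵇ k s′ g′ ] h g
          ≈⟨ sym ([]-∧ (s Fin.zero g₀) _ _) ⟩
        [ allᵇ (suc k) s g ] h g ∎
        where
        rest : List (Fin k → A)
        rest = allFuns k (λ i → ch (Fin.suc i))
        g₀ : A
        g₀ = g Fin.zero
        g′ : Fin k → A
        g′ i = g (Fin.suc i)
        s′ : Fin k → A → Bool
        s′ i = s (Fin.suc i)
        cons-R : ∀ {v f} → R v g₀ → (∀ i → R (f i) (g′ i)) → ∀ i → R (cons v f i) (g i)
        cons-R {v} {f} rv rf Fin.zero    = subst (λ x → R x g₀) (≡.sym (cons-zero v f)) rv
        cons-R {v} {f} rv rf (Fin.suc i) = subst (λ x → R x (g′ i)) (≡.sym (cons-suc v f i)) (rf i)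
        H : A → Carrier
        H v = [ allᵇ k s′ g′ ] h (cons v g′)
        H-resp : ∀ v → R v g₀ → H v ≈ H g₀
        H-resp v rv = []-cong (allᵇ k s′ g′) (trans (h-resp _ (cons-R rv (λ i → R-refl (g′ i))))
                                                 (sym (h-resp _ (cons-R (R-refl g₀) (λ i → R-refl (g′ i))))))
        cons-≟ : ∀ v f → does (pointwise? R? (cons v f) g) ≡ (does (R? v g₀) ∧ does (pointwise? R? f g′))
        cons-≟ v f = does-⇔ (mk⇔ (λ x → subst (λ y → R y g₀) (cons-zero v f) (x Fin.zero) ,
                                        (λ i → subst (λ y → R y (g′ i)) (cons-suc v f i) (x (Fin.suc i))))
                                  (λ x → cons-R (proj₁ x) (proj₂ x)))
                            (pointwise? R? (cons v f) g) (R? v g₀ ×-dec pointwise? R? f g′)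
        inner : ∀ v → ∑ rest (λ f → [ does (pointwise? R? (cons v f) g) ] h (cons v f)) ≈ [ does (R? v g₀) ] H v
        inner v = trans (∑-cong rest (λ f → trans ([]-congᵇ _ (cons-≟ v f)) ([]-∧ (does (R? v g₀)) _ (h (cons v f)))))
                    (trans (∑-[] _ rest _) (at (R? v g₀)))
          where
          at : (d : Dec (R v g₀)) → [ does d ] ∑ rest (λ f → [ does (pointwise? R? f g′) ] h (cons v f)) ≈ [ does d ] H v
          at (no _)   = trans ([]-false _ ≡.refl) (sym ([]-false _ ≡.refl))
          at (yes rv) = []-cong true (tail-enum g′ (λ f → h (cons v f))
                          (λ f rf → trans (h-resp _ (cons-R rv rf)) (sym (h-resp _ (cons-R rv (λ i → R-refl (g′ i)))))))

    allFuns-enumerates : ∀ k (ch : Fin k → List A) (s : Fin k → A → Bool) → (∀ i → Enumerates (ch i) R? (s i)) →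
                         Enumerates (allFuns k ch) (pointwise? R? {k}) (allᵇ k s)
    allFuns-enumerates zero    ch s _      g h h-resp =
      trans (+-identityʳ _) (trans ([]-true _ ≡.refl) (trans (h-resp _ (λ ())) (sym ([]-true _ ≡.refl))))
    allFuns-enumerates (suc k) ch s ch-enum g h h-resp =
      trans (∑-concatMap (ch Fin.zero) _ _)
        (trans (∑-cong (ch Fin.zero) (λ v → ∑-map (allFuns k (λ i → ch (Fin.suc i))) _ _))
               (∑-cons k ch s g h _ (λ _ _ → ≡.refl) (λ _ _ _ → ≡.refl) ch-enum h-resp
                  (allFuns-enumerates k (λ i → ch (Fin.suc i)) (λ i → s (Fin.suc i)) (λ i → ch-enum (Fin.suc i)))))

-- Increasing maps

Increasing : ∀ {m n} → (Fin m → Fin n) → Set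
Increasing {m} φ = ∀ (a b : Fin m) → a Fin.< b → φ a Fin.< φ b

Onto : ∀ {m n} → (Fin m → Fin n) → Set
Onto {m} θ = ∀ b → ∃ λ a → θ a ≡ b

module _ {m n} {φ : Fin m → Fin n} (φ↑ : Increasing φ) where

  increasing⇒injective : ∀ a b → φ a ≡ φ b → a ≡ b
  increasing⇒injective a b e with Finₚ.<-cmp a b
  ... | tri< a<b _ _ = ⊥-elim (Finₚ.<⇒≢ (φ↑ a b a<b) e)
  ... | tri≈ _ a≡b _ = a≡b
  ... | tri> _ _ b<a = ⊥-elim (Finₚ.<⇒≢ (φ↑ b a b<a) (≡.sym e))

  increasing-reflects-< : ∀ a b → φ a Fin.< φ b → a Fin.< b
  increasing-reflects-< a b φa<φb with Finₚ.<-cmp a b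
  ... | tri< a<b _ _   = a<b
  ... | tri≈ _ ≡.refl _ = ⊥-elim (ℕₚ.<-irrefl ≡.refl φa<φb)
  ... | tri> _ _ b<a   = ⊥-elim (ℕₚ.<-asym φa<φb (φ↑ b a b<a))

  increasing-inflationary : ∀ a → toℕ a ≤ toℕ (φ a)
  increasing-inflationary a = go (toℕ a) a ≡.refl
    where
    go : ∀ i a → toℕ a ≡ i → toℕ a ≤ toℕ (φ a)
    go zero    a e = subst (_≤ toℕ (φ a)) (≡.sym e) z≤n
    go (suc i) a e = subst (_≤ toℕ (φ a)) (≡.sym e) (ℕₚ.≤-trans (s≤s ih) (φ↑ a⁻ a a⁻<a))
      where
      i<m : i < m
      i<m = ℕₚ.<-trans (ℕₚ.n<1+n i) (subst (_< m) e (toℕ<n a))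
      a⁻ : Fin m
      a⁻ = fromℕ< i<m
      a⁻<a : a⁻ Fin.< a
      a⁻<a = subst₂ _<_ (≡.sym (toℕ-fromℕ< _)) (≡.sym e) (ℕₚ.n<1+n i)
      ih : i ≤ toℕ (φ a⁻)
      ih = subst (_≤ toℕ (φ a⁻)) (toℕ-fromℕ< i<m) (go i a⁻ (toℕ-fromℕ< i<m))

increasing-∘ : ∀ {m n o} {φ : Fin m → Fin n} {χ : Fin n → Fin o} → Increasing χ → Increasing φ → Increasing (λ a → χ (φ a))
increasing-∘ χ↑ φ↑ a b a<b = χ↑ _ _ (φ↑ a b a<b)

module _ {p q} {θ : Fin p → Fin q} (θ↑ : Increasing θ) (θ-onto : Onto θ) where

  increasing-onto-fixes : ∀ a → toℕ (θ a) ≡ toℕ a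
  increasing-onto-fixes a = go (suc (toℕ a)) a (ℕₚ.n<1+n _)
    where
    go : ∀ i a → toℕ a < i → toℕ (θ a) ≡ toℕ a
    go (suc i) a a<1+i = ℕₚ.≤-antisym θa≤a (increasing-inflationary θ↑ a)
      where
      a<q : toℕ a < q
      a<q = ℕₚ.≤-<-trans (increasing-inflationary θ↑ a) (toℕ<n (θ a))
      a′ : Fin p
      a′ = proj₁ (θ-onto (fromℕ< a<q))
      θa′≡a : toℕ (θ a′) ≡ toℕ a
      θa′≡a = ≡.trans (cong toℕ (proj₂ (θ-onto (fromℕ< a<q)))) (toℕ-fromℕ< a<q)
      a′≡a : a′ ≡ a
      a′≡a with Finₚ.<-cmp a′ a
      ... | tri≈ _ e _  = e
      ... | tri< a′<a _ _ = ⊥-elim (ℕₚ.<-irrefl (≡.trans (≡.sym (go i a′ (ℕₚ.<-≤-trans a′<a (ℕₚ.≤-pred a<1+i)))) θa′≡a) a′<a)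
      ... | tri> _ _ a<a′ = ⊥-elim (ℕₚ.<⇒≱ (subst (toℕ (θ a) <_) θa′≡a (θ↑ a a′ a<a′)) (increasing-inflationary θ↑ a))
      θa≤a : toℕ (θ a) ≤ toℕ a
      θa≤a = ℕₚ.≤-reflexive (≡.trans (cong (λ x → toℕ (θ x)) (≡.sym a′≡a)) θa′≡a)

  increasing-onto⇒≡ : p ≡ q
  increasing-onto⇒≡ = ℕₚ.≤-antisym p≤q q≤p
    where
    p≤q : p ≤ q
    p≤q with p ℕ.≤? q
    ... | yes p≤q = p≤q
    ... | no  p≰q = ⊥-elim (ℕₚ.<-irrefl (≡.trans (increasing-onto-fixes a) (toℕ-fromℕ< q<p)) (toℕ<n (θ a)))
      where
      q<p : q < p
      q<p = ℕₚ.≰⇒> p≰q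
      a = fromℕ< q<p
    q≤p : q ≤ p
    q≤p with q ℕ.≤? p
    ... | yes q≤p = q≤p
    ... | no  q≰p = ⊥-elim (ℕₚ.<-irrefl (≡.trans (≡.sym (increasing-onto-fixes a)) (≡.trans (cong toℕ θa≡p) (toℕ-fromℕ< p<q))) (toℕ<n a))
      where
      p<q : p < q
      p<q = ℕₚ.≰⇒> q≰p
      a = proj₁ (θ-onto (fromℕ< p<q))
      θa≡p : θ a ≡ fromℕ< p<q
      θa≡p = proj₂ (θ-onto (fromℕ< p<q))

increasing-same-image : ∀ {p p′ n} {χ : Fin p → Fin n} {χ′ : Fin p′ → Fin n} → Increasing χ → Increasing χ′ →
  (∀ a → ∃ λ b → χ a ≡ χ′ b) → (∀ b → ∃ λ a → χ′ b ≡ χ a) →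
  p ≡ p′ × (∀ a a′ → toℕ a ≡ toℕ a′ → χ a ≡ χ′ a′)
increasing-same-image {p} {p′} {χ = χ} {χ′} χ↑ χ′↑ im⊆ im⊇ = increasing-onto⇒≡ θ↑ θ-onto , χ≗χ′
  where
  θ : Fin p → Fin p′
  θ a = proj₁ (im⊆ a)
  θ↑ : Increasing θ
  θ↑ a b a<b = increasing-reflects-< χ′↑ (θ a) (θ b) (subst₂ Fin._<_ (proj₂ (im⊆ a)) (proj₂ (im⊆ b)) (χ↑ a b a<b))
  θ-onto : Onto θ
  θ-onto b = proj₁ (im⊇ b) , ≡.sym (increasing⇒injective χ′↑ _ _ (≡.trans (proj₂ (im⊇ b)) (proj₂ (im⊆ (proj₁ (im⊇ b))))))
  χ≗χ′ : ∀ a a′ → toℕ a ≡ toℕ a′ → χ a ≡ χ′ a′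
  χ≗χ′ a a′ e = ≡.trans (proj₂ (im⊆ a)) (cong χ′ (toℕ-injective (≡.trans (increasing-onto-fixes θ↑ θ-onto a) e)))

enumerate : ∀ n → (Fin n → Bool) → Σ ℕ (λ p → Fin p → Fin n)
enumerate zero    S = 0 , (λ ())
enumerate (suc n) S = extend (S Fin.zero) (enumerate n (λ i → S (Fin.suc i)))
  where
  extend : Bool → Σ ℕ (λ p → Fin p → Fin n) → Σ ℕ (λ p → Fin p → Fin (suc n))
  extend true  (p , χ) = suc p , Fin.lift 1 χ
  extend false (p , χ) = p , λ j → Fin.suc (χ j)

module _ {n} (S : Fin n → Bool) where

  enumerate-increasing : Increasing (proj₂ (enumerate n S))
  enumerate-increasing = go n S
    where
    go : ∀ n (S : Fin n → Bool) → Increasing (proj₂ (enumerate n S))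
    go (suc n) S with S Fin.zero | go n (λ i → S (Fin.suc i))
    ... | true  | χ↑ = λ { Fin.zero (Fin.suc b) _ → s≤s z≤n ; (Fin.suc a) (Fin.suc b) (s≤s a<b) → s≤s (χ↑ a b a<b) }
    ... | false | χ↑ = λ a b a<b → s≤s (χ↑ a b a<b)

  enumerate-⊆ : ∀ a → S (proj₂ (enumerate n S) a) ≡ true
  enumerate-⊆ = go n S
    where
    go : ∀ n (S : Fin n → Bool) a → S (proj₂ (enumerate n S) a) ≡ true
    go (suc n) S a with S Fin.zero in eq | go n (λ i → S (Fin.suc i))
    go (suc n) S Fin.zero    | true | _   = eq
    go (suc n) S (Fin.suc a) | true | ih  = ih a
    go (suc n) S a           | false | ih = ih a

  enumerate-⊇ : ∀ i → S i ≡ true → ∃ λ a → proj₂ (enumerate n S) a ≡ i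
  enumerate-⊇ = go n S
    where
    go : ∀ n (S : Fin n → Bool) i → S i ≡ true → ∃ λ a → proj₂ (enumerate n S) a ≡ i
    go (suc n) S i Si with S Fin.zero in eq | go n (λ i → S (Fin.suc i))
    go (suc n) S Fin.zero    Si | true  | _  = Fin.zero , ≡.refl
    go (suc n) S (Fin.suc i) Si | true  | ih = let a , e = ih i Si in Fin.suc a , cong Fin.suc e
    go (suc n) S Fin.zero    Si | false | _  with () ← ≡.trans (≡.sym Si) eq
    go (suc n) S (Fin.suc i) Si | false | ih = let a , e = ih i Si in a , cong Fin.suc e

JointlySurjective : ∀ {m k p} → (Fin m → Fin p) → (Fin k → Fin p) → Set
JointlySurjective {p = p} σ τ = ∀ (a : Fin p) → (∃ λ j → σ j ≡ a) ⊎ (∃ λ j → τ j ≡ a)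

module _ {m k p} (σ : Fin m → Fin p) (τ : Fin k → Fin p) (J : JointlySurjective σ τ) where
  private
    preimage : Fin p → Fin (m ℕ.+ k)
    preimage a with J a
    ... | inj₁ (j , _) = j ↑ˡ k
    ... | inj₂ (j , _) = m ↑ʳ j

    ↑ˡ≢↑ʳ : ∀ j j′ → j ↑ˡ k ≢ m ↑ʳ j′
    ↑ˡ≢↑ʳ j j′ e = ℕₚ.<⇒≢ (ℕₚ.<-≤-trans (toℕ<n j) (ℕₚ.m≤m+n m (toℕ j′)))
                          (≡.trans (≡.sym (Finₚ.toℕ-↑ˡ j k)) (≡.trans (cong toℕ e) (Finₚ.toℕ-↑ʳ m j′)))

    preimage-injective : ∀ a b → preimage a ≡ preimage b → a ≡ b
    preimage-injective a b e with J a | J b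
    ... | inj₁ (j , ea) | inj₁ (j′ , eb) = ≡.trans (≡.sym ea) (≡.trans (cong σ (Finₚ.↑ˡ-injective k j j′ e)) eb)
    ... | inj₂ (j , ea) | inj₂ (j′ , eb) = ≡.trans (≡.sym ea) (≡.trans (cong τ (Finₚ.↑ʳ-injective m j j′ e)) eb)
    ... | inj₁ (j , _)  | inj₂ (j′ , _)  = ⊥-elim (↑ˡ≢↑ʳ j j′ e)
    ... | inj₂ (j , _)  | inj₁ (j′ , _)  = ⊥-elim (↑ˡ≢↑ʳ j′ j (≡.sym e))

  jointlySurjective⇒≤ : p ≤ m ℕ.+ k
  jointlySurjective⇒≤ with p ℕ.≤? m ℕ.+ k
  ... | yes p≤m+k = p≤m+k
  ... | no  p≰m+k with a , b , a<b , e ← Finₚ.pigeonhole (ℕₚ.≰⇒> p≰m+k) preimage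
    = ⊥-elim (Finₚ.<⇒≢ a<b (preimage-injective a b e))

module _ where
  open FiniteSum +-*-commutativeSemiring
  open ≡.≡-Reasoning

  private
    δ : ∀ {n} → Fin n → Fin n → Bool
    δ a b = does (a ≟F b)

    δ-sym : ∀ {n} (a b : Fin n) → δ a b ≡ δ b a
    δ-sym a b = does-⇔ (mk⇔ ≡.sym ≡.sym) (a ≟F b) (b ≟F a)

    ∑-δ : ∀ {n} (x : Fin n) (f : Fin n → ℕ) → ∑ (allFin n) (λ a → [ δ x a ] f a) ≡ f x
    ∑-δ {n} x f = begin
      ∑ (allFin n) (λ a → [ δ x a ] f a) ≡⟨ ∑-cong (allFin n) (λ a → []-congᵇ (f a) (δ-sym x a)) ⟩
      ∑ (allFin n) (λ a → [ δ a x ] f a) ≡⟨ allFin-enumerates n x f (λ { _ ≡.refl → ≡.refl }) ⟩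
      [ true ] f x                       ≡⟨ []-true _ ≡.refl ⟩
      f x                                ∎

  push-as-∑ : ∀ {m n} (φ : Fin m → Fin n) (A : Mat m) p q →
              push φ A p q ≡ ∑ (allFin m) (λ j → ∑ (allFin m) (λ k → [ δ (φ j) p ] [ δ (φ k) q ] A j k))
  push-as-∑ {m} φ A p q = ≡.sym (∑-cong (allFin m) λ j → ∑-cong (allFin m) λ k →
    ≡.trans ([]-unfold _ _) (cong (λ y → if δ (φ j) p then y else 0) ([]-unfold _ _)))

  push-cong : ∀ {m n} (φ : Fin m → Fin n) {A B : Mat m} → (∀ j k → A j k ≡ B j k) → ∀ p q → push φ A p q ≡ push φ B p q
  push-cong {m} φ {A} {B} A≗B p q = begin
    push φ A p q                                                               ≡⟨ push-as-∑ φ A p q ⟩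
    ∑ (allFin m) (λ j → ∑ (allFin m) (λ k → [ δ (φ j) p ] [ δ (φ k) q ] A j k)) ≡⟨ ∑-cong (allFin m) (λ j → ∑-cong (allFin m) λ k →
                                                                                    cong (λ x → [ δ (φ j) p ] [ δ (φ k) q ] x) (A≗B j k)) ⟩
    ∑ (allFin m) (λ j → ∑ (allFin m) (λ k → [ δ (φ j) p ] [ δ (φ k) q ] B j k)) ≡⟨ ≡.sym (push-as-∑ φ B p q) ⟩
    push φ B p q                                                               ∎

  push-cong-map : ∀ {m n} {φ φ′ : Fin m → Fin n} (A : Mat m) → (∀ j → φ j ≡ φ′ j) → ∀ p q → push φ A p q ≡ push φ′ A p q
  push-cong-map {m} {φ = φ} {φ′} A φ≗φ′ p q = begin
    push φ A p q                                                                 ≡⟨ push-as-∑ φ A p q ⟩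
    ∑ (allFin m) (λ j → ∑ (allFin m) (λ k → [ δ (φ j) p ] [ δ (φ k) q ] A j k))   ≡⟨ ∑-cong (allFin m) (λ j → ∑-cong (allFin m) λ k →
                                                                                      cong₂ (λ x y → [ δ x p ] [ δ y q ] A j k) (φ≗φ′ j) (φ≗φ′ k)) ⟩
    ∑ (allFin m) (λ j → ∑ (allFin m) (λ k → [ δ (φ′ j) p ] [ δ (φ′ k) q ] A j k)) ≡⟨ ≡.sym (push-as-∑ φ′ A p q) ⟩
    push φ′ A p q                                                                ∎

  push-+ : ∀ {m n} (φ : Fin m → Fin n) (M N : Mat m) p q →
           push φ (λ a b → M a b ℕ.+ N a b) p q ≡ push φ M p q ℕ.+ push φ N p q
  push-+ {m} φ M N p q = begin
    push φ (λ a b → M a b ℕ.+ N a b) p q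
      ≡⟨ push-as-∑ φ _ p q ⟩
    ∑ (allFin m) (λ j → ∑ (allFin m) (λ k → [ δ (φ j) p ] [ δ (φ k) q ] (M j k ℕ.+ N j k)))
      ≡⟨ ∑-cong (allFin m) (λ j → ≡.trans (∑-cong (allFin m) λ k →
           ≡.trans (cong [ δ (φ j) p ]_ ([]-+ (δ (φ k) q) (M j k) (N j k))) ([]-+ (δ (φ j) p) _ _)) (∑-+ (allFin m) _ _)) ⟩
    ∑ (allFin m) (λ j → ∑ (allFin m) (λ k → [ δ (φ j) p ] [ δ (φ k) q ] M j k) ℕ.+ ∑ (allFin m) (λ k → [ δ (φ j) p ] [ δ (φ k) q ] N j k))
      ≡⟨ ∑-+ (allFin m) _ _ ⟩
    ∑ (allFin m) (λ j → ∑ (allFin m) (λ k → [ δ (φ j) p ] [ δ (φ k) q ] M j k)) ℕ.+ ∑ (allFin m) (λ j → ∑ (allFin m) (λ k → [ δ (φ j) p ] [ δ (φ k) q ] N j k))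
      ≡⟨ ≡.sym (cong₂ ℕ._+_ (push-as-∑ φ M p q) (push-as-∑ φ N p q)) ⟩
    push φ M p q ℕ.+ push φ N p q ∎

  push-∘ : ∀ {m n o} (σ : Fin m → Fin n) (χ : Fin n → Fin o) (A : Mat m) p q →
           push χ (push σ A) p q ≡ push (λ j → χ (σ j)) A p q
  push-∘ {m} {n} σ χ A p q = begin
    push χ (push σ A) p q
      ≡⟨ push-as-∑ χ (push σ A) p q ⟩
    ∑ Fn (λ a → ∑ Fn λ b → [ δ (χ a) p ] [ δ (χ b) q ] push σ A a b)
      ≡⟨ ∑-cong Fn (λ a → ∑-cong Fn λ b → cong (λ x → [ δ (χ a) p ] [ δ (χ b) q ] x) (push-as-∑ σ A a b)) ⟩
    ∑ Fn (λ a → ∑ Fn λ b → [ δ (χ a) p ] [ δ (χ b) q ] ∑ Fm λ j → ∑ Fm λ l → [ δ (σ j) a ] [ δ (σ l) b ] A j l)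
      ≡⟨ ∑-cong Fn (λ a → ∑-cong Fn λ b → push-brackets-in a b) ⟩
    ∑ Fn (λ a → ∑ Fn λ b → ∑ Fm λ j → ∑ Fm λ l → [ δ (σ j) a ] [ δ (σ l) b ] [ δ (χ a) p ] [ δ (χ b) q ] A j l)
      ≡⟨ ≡.trans (∑-cong Fn λ a → ∑-comm Fn Fm _) (≡.trans (∑-comm Fn Fm _) (∑-cong Fm λ j → ∑-cong Fn λ a → ∑-comm Fn Fm _)) ⟩
    ∑ Fm (λ j → ∑ Fn λ a → ∑ Fm λ l → ∑ Fn λ b → [ δ (σ j) a ] [ δ (σ l) b ] [ δ (χ a) p ] [ δ (χ b) q ] A j l)
      ≡⟨ ∑-cong Fm (λ j → ≡.trans (∑-comm Fn Fm _) (∑-cong Fm λ l → collapse j l)) ⟩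
    ∑ Fm (λ j → ∑ Fm λ l → [ δ (χ (σ j)) p ] [ δ (χ (σ l)) q ] A j l)
      ≡⟨ ≡.sym (push-as-∑ (λ j → χ (σ j)) A p q) ⟩
    push (λ j → χ (σ j)) A p q ∎
    where
    Fn : List (Fin n)
    Fn = allFin n
    Fm : List (Fin m)
    Fm = allFin m
    push-brackets-in : ∀ a b → [ δ (χ a) p ] [ δ (χ b) q ] ∑ Fm (λ j → ∑ Fm λ l → [ δ (σ j) a ] [ δ (σ l) b ] A j l) ≡
                               ∑ Fm (λ j → ∑ Fm λ l → [ δ (σ j) a ] [ δ (σ l) b ] [ δ (χ a) p ] [ δ (χ b) q ] A j l)
    push-brackets-in a b = ≡.sym (begin
      ∑ Fm (λ j → ∑ Fm λ l → [ δ (σ j) a ] [ δ (σ l) b ] [ δ (χ a) p ] [ δ (χ b) q ] A j l)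
        ≡⟨ ∑-cong Fm (λ j → ∑-cong Fm λ l → reorder j l) ⟩
      ∑ Fm (λ j → ∑ Fm λ l → [ δ (χ a) p ] [ δ (χ b) q ] [ δ (σ j) a ] [ δ (σ l) b ] A j l)
        ≡⟨ ∑-cong Fm (λ j → ≡.trans (∑-[] (δ (χ a) p) Fm _) (cong [ δ (χ a) p ]_ (∑-[] (δ (χ b) q) Fm _))) ⟩
      ∑ Fm (λ j → [ δ (χ a) p ] [ δ (χ b) q ] ∑ Fm λ l → [ δ (σ j) a ] [ δ (σ l) b ] A j l)
        ≡⟨ ≡.trans (∑-[] (δ (χ a) p) Fm _) (cong [ δ (χ a) p ]_ (∑-[] (δ (χ b) q) Fm _)) ⟩
      [ δ (χ a) p ] [ δ (χ b) q ] ∑ Fm (λ j → ∑ Fm λ l → [ δ (σ j) a ] [ δ (σ l) b ] A j l) ∎)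
      where
      reorder : ∀ j l → [ δ (σ j) a ] [ δ (σ l) b ] [ δ (χ a) p ] [ δ (χ b) q ] A j l ≡
                        [ δ (χ a) p ] [ δ (χ b) q ] [ δ (σ j) a ] [ δ (σ l) b ] A j l
      reorder j l = begin
        [ δ (σ j) a ] [ δ (σ l) b ] [ δ (χ a) p ] [ δ (χ b) q ] A j l ≡⟨ cong [ δ (σ j) a ]_ ([]-comm _ _ _) ⟩
        [ δ (σ j) a ] [ δ (χ a) p ] [ δ (σ l) b ] [ δ (χ b) q ] A j l ≡⟨ cong [ δ (σ j) a ]_ (cong [ δ (χ a) p ]_ ([]-comm _ _ _)) ⟩
        [ δ (σ j) a ] [ δ (χ a) p ] [ δ (χ b) q ] [ δ (σ l) b ] A j l ≡⟨ []-comm _ _ _ ⟩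
        [ δ (χ a) p ] [ δ (σ j) a ] [ δ (χ b) q ] [ δ (σ l) b ] A j l ≡⟨ cong [ δ (χ a) p ]_ ([]-comm _ _ _) ⟩
        [ δ (χ a) p ] [ δ (χ b) q ] [ δ (σ j) a ] [ δ (σ l) b ] A j l ∎
    collapse : ∀ j l → ∑ Fn (λ a → ∑ Fn λ b → [ δ (σ j) a ] [ δ (σ l) b ] [ δ (χ a) p ] [ δ (χ b) q ] A j l) ≡
                       [ δ (χ (σ j)) p ] [ δ (χ (σ l)) q ] A j l
    collapse j l = ≡.trans (∑-cong Fn λ a → ∑-[] (δ (σ j) a) Fn _) (≡.trans (∑-δ (σ j) _) (∑-δ (σ l) _))

  push-id : ∀ {m} (A : Mat m) p q → push (λ j → j) A p q ≡ A p q
  push-id {m} A p q = begin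
    push (λ j → j) A p q                                              ≡⟨ push-as-∑ (λ j → j) A p q ⟩
    ∑ (allFin m) (λ j → ∑ (allFin m) λ k → [ δ j p ] [ δ k q ] A j k)  ≡⟨ ∑-cong (allFin m) (λ j → ∑-[] (δ j p) (allFin m) _) ⟩
    ∑ (allFin m) (λ j → [ δ j p ] ∑ (allFin m) λ k → [ δ k q ] A j k)  ≡⟨ allFin-enumerates m p _ (λ { _ ≡.refl → ≡.refl }) ⟩
    [ true ] ∑ (allFin m) (λ k → [ δ k q ] A p k)                      ≡⟨ ≡.trans ([]-true _ ≡.refl) (allFin-enumerates m q (A p) (λ { _ ≡.refl → ≡.refl })) ⟩
    [ true ] A p q                                                    ≡⟨ []-true _ ≡.refl ⟩
    A p q                                                             ∎

  push-symmetric : ∀ {m n} (φ : Fin m → Fin n) (A : Mat m) → Symmetric A → ∀ p q → push φ A p q ≡ push φ A q p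
  push-symmetric {m} φ A A-sym p q = begin
    push φ A p q                                                                 ≡⟨ push-as-∑ φ A p q ⟩
    ∑ (allFin m) (λ j → ∑ (allFin m) λ k → [ δ (φ j) p ] [ δ (φ k) q ] A j k)    ≡⟨ ∑-comm (allFin m) (allFin m) _ ⟩
    ∑ (allFin m) (λ k → ∑ (allFin m) λ j → [ δ (φ j) p ] [ δ (φ k) q ] A j k)    ≡⟨ ∑-cong (allFin m) (λ k → ∑-cong (allFin m) λ j →
                                                                                     ≡.trans ([]-comm _ _ _) (cong (λ x → [ δ (φ k) q ] [ δ (φ j) p ] x) (A-sym j k))) ⟩
    ∑ (allFin m) (λ k → ∑ (allFin m) λ j → [ δ (φ k) q ] [ δ (φ j) p ] A k j)    ≡⟨ ≡.sym (push-as-∑ φ A q p) ⟩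
    push φ A q p                                                                 ∎

  push-zeroDiagonal : ∀ {m n} (φ : Fin m → Fin n) (A : Mat m) → (∀ a b → φ a ≡ φ b → a ≡ b) → ZeroDiagonal A → ∀ p → push φ A p p ≡ 0
  push-zeroDiagonal {m} φ A φ-injective A-zd p =
    ≡.trans (push-as-∑ φ A p p) (∑-zero (allFin m) λ j → ∑-zero (allFin m) λ k → term j k (φ j ≟F p) (φ k ≟F p))
    where
    term : ∀ j k (d : Dec (φ j ≡ p)) (d′ : Dec (φ k ≡ p)) → [ does d ] [ does d′ ] A j k ≡ 0
    term j k (no _)   _        = []-false _ ≡.refl
    term j k (yes _)  (no _)   = ≡.trans ([]-true _ ≡.refl) ([]-false _ ≡.refl)
    term j k (yes φj≡p) (yes φk≡p) rewrite φ-injective j k (≡.trans φj≡p (≡.sym φk≡p)) =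
      ≡.trans ([]-true _ ≡.refl) (≡.trans ([]-true _ ≡.refl) (A-zd k))

  ≤-push : ∀ {m n} (φ : Fin m → Fin n) (A : Mat m) j k → A j k ≤ push φ A (φ j) (φ k)
  ≤-push {m} φ A j k =
    ℕₚ.≤-trans (ℕₚ.≤-reflexive (≡.sym (≡.trans ([]-true _ (dec-true (φ j ≟F φ j) ≡.refl)) ([]-true _ (dec-true (φ k ≟F φ k) ≡.refl)))))
   (ℕₚ.≤-trans (≤-∑ (allFin m) _ (∈-allFin k))
   (ℕₚ.≤-trans (≤-∑ (allFin m) (λ j′ → ∑ (allFin m) λ k′ → [ δ (φ j′) (φ j) ] [ δ (φ k′) (φ k) ] A j′ k′) (∈-allFin j))
               (ℕₚ.≤-reflexive (≡.sym (push-as-∑ φ A (φ j) (φ k))))))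
    where
    ≤-∑ : ∀ {a} {X : Set a} {x} (l : List X) (f : X → ℕ) → x ∈ l → f x ≤ ∑ l f
    ≤-∑ (y ∷ l) f (here ≡.refl) = ℕₚ.m≤m+n _ _
    ≤-∑ (y ∷ l) f (there x∈l)   = ℕₚ.≤-trans (≤-∑ l f x∈l) (ℕₚ.m≤n+m _ _)

  private
    ∑-nonzero : ∀ {a} {X : Set a} (l : List X) (f : X → ℕ) → ∑ l f ≢ 0 → ∃ λ x → f x ≢ 0
    ∑-nonzero []      f ∑≢0 = ⊥-elim (∑≢0 ≡.refl)
    ∑-nonzero (y ∷ l) f ∑≢0 with f y ℕₚ.≟ 0
    ... | no  fy≢0 = y , fy≢0
    ... | yes fy≡0 = ∑-nonzero l f (λ e → ∑≢0 (≡.trans (cong (ℕ._+ ∑ l f) fy≡0) e))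
    []-nonzero : ∀ {p} {X : Set p} (d : Dec X) x → [ does d ] x ≢ 0 → X
    []-nonzero (yes x) _ _   = x
    []-nonzero (no _)  x ≢0 = ⊥-elim (≢0 ([]-false _ ≡.refl))

  push-nonzero : ∀ {m n} (φ : Fin m → Fin n) (A : Mat m) p q → push φ A p q ≢ 0 → ∃ λ j → ∃ λ k → φ j ≡ p × φ k ≡ q
  push-nonzero {m} φ A p q push≢0
    with j , ≢0  ← ∑-nonzero (allFin m) _ (λ e → push≢0 (≡.trans (push-as-∑ φ A p q) e))
    with k , ≢0′ ← ∑-nonzero (allFin m) _ ≢0
    = j , k , []-nonzero (φ j ≟F p) _ ≢0′ , []-nonzero (φ k ≟F q) _ (λ e → ≢0′ (≡.trans (cong [ δ (φ j) p ]_ e) ([]-0 _)))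

does⇒ : ∀ {p} {X : Set p} (d : Dec X) → does d ≡ true → X
does⇒ (yes x) _ = x

T-does⇒ : ∀ {p} {X : Set p} (d : Dec X) → T (does d) → X
T-does⇒ (yes x) _ = x

increasing-dec : ∀ {m n} (φ : Fin m → Fin n) → Dec (Increasing φ)
increasing-dec φ = all? (λ j → all? (λ k → (j Fin.<? k) →-dec (φ j Fin.<? φ k)))

sameMat?⇒ : ∀ {n} {e e′ : Mat n} → sameMat? e e′ ≡ true → ∀ p q → e p q ≡ e′ p q
sameMat?⇒ t = does⇒ (all? _) t

sameMat?-cong : ∀ {n} {e₁ e₁′ e₂ e₂′ : Mat n} → (∀ p q → e₁ p q ≡ e₁′ p q) → (∀ p q → e₂ p q ≡ e₂′ p q) →
                sameMat? e₁ e₂ ≡ sameMat? e₁′ e₂′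
sameMat?-cong e₁≗ e₂≗ = does-⇔ (mk⇔ (λ f p q → ≡.trans (≡.sym (e₁≗ p q)) (≡.trans (f p q) (e₂≗ p q)))
                                     (λ f p q → ≡.trans (e₁≗ p q) (≡.trans (f p q) (≡.sym (e₂≗ p q)))))
                               (all? _) (all? _)

_≐_ : ∀ {m n} (f g : Fin m → Fin n) → Dec (∀ i → f i ≡ g i)
f ≐ g = pointwise? _≟F_ f g

maps : (m n : ℕ) → List (Fin m → Fin n)
maps m n = allFuns m (λ _ → allFin n)

-- Quasi-shuffles

QuasiShuffle : ∀ {m k p} → (Fin m → Fin p) → (Fin k → Fin p) → Set
QuasiShuffle σ τ = Increasing σ × Increasing τ × JointlySurjective σ τ

quasiShuffle? : ∀ {m k p} (σ : Fin m → Fin p) (τ : Fin k → Fin p) → Dec (QuasiShuffle σ τ)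
quasiShuffle? σ τ = increasing-dec σ ×-dec (increasing-dec τ ×-dec all? (λ a → any? (λ j → σ j ≟F a) ⊎-dec any? (λ j → τ j ≟F a)))

Factorises : ∀ {m k n p} → (Fin m → Fin n) → (Fin k → Fin n) → (Fin m → Fin p) → (Fin k → Fin p) → (Fin p → Fin n) → Set
Factorises φ ψ σ τ χ = QuasiShuffle σ τ × Increasing χ × (∀ j → φ j ≡ χ (σ j)) × (∀ j → ψ j ≡ χ (τ j))

factorises? : ∀ {m k n p} (φ : Fin m → Fin n) (ψ : Fin k → Fin n) (σ : Fin m → Fin p) (τ : Fin k → Fin p) (χ : Fin p → Fin n) →
              Dec (Factorises φ ψ σ τ χ)
factorises? φ ψ σ τ χ = quasiShuffle? σ τ ×-dec (increasing-dec χ ×-dec (φ ≐ (λ j → χ (σ j)) ×-dec ψ ≐ (λ j → χ (τ j))))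

-- The factorisation of a pair of increasing maps exists and is unique: χ must enumerate the union of the two images.
module Factorisation {m k n} {φ : Fin m → Fin n} {ψ : Fin k → Fin n} (φ↑ : Increasing φ) (ψ↑ : Increasing ψ) where

  private
    InImage : Fin n → Set
    InImage i = (∃ λ j → φ j ≡ i) ⊎ (∃ λ j → ψ j ≡ i)

    inImage? : ∀ i → Dec (InImage i)
    inImage? i = any? (λ j → φ j ≟F i) ⊎-dec any? (λ j → ψ j ≟F i)

    inImage : Fin n → Bool
    inImage i = does (inImage? i)

  p₀ : ℕ
  p₀ = proj₁ (enumerate n inImage)

  χ₀ : Fin p₀ → Fin n
  χ₀ = proj₂ (enumerate n inImage)

  private
    χ₀↑ : Increasing χ₀
    χ₀↑ = enumerate-increasing inImage

    χ₀-onto : ∀ i → InImage i → ∃ λ a → χ₀ a ≡ i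
    χ₀-onto i x = enumerate-⊇ inImage i (dec-true (inImage? i) x)

    χ₀-into : ∀ a → InImage (χ₀ a)
    χ₀-into a = does⇒ (inImage? (χ₀ a)) (enumerate-⊆ inImage a)

  σ₀ : Fin m → Fin p₀
  σ₀ j = proj₁ (χ₀-onto (φ j) (inj₁ (j , ≡.refl)))

  τ₀ : Fin k → Fin p₀
  τ₀ j = proj₁ (χ₀-onto (ψ j) (inj₂ (j , ≡.refl)))

  private
    χ₀σ₀ : ∀ j → χ₀ (σ₀ j) ≡ φ j
    χ₀σ₀ j = proj₂ (χ₀-onto (φ j) (inj₁ (j , ≡.refl)))

    χ₀τ₀ : ∀ j → χ₀ (τ₀ j) ≡ ψ j
    χ₀τ₀ j = proj₂ (χ₀-onto (ψ j) (inj₂ (j , ≡.refl)))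

    σ₀↑ : Increasing σ₀
    σ₀↑ a b a<b = increasing-reflects-< χ₀↑ _ _ (subst₂ Fin._<_ (≡.sym (χ₀σ₀ a)) (≡.sym (χ₀σ₀ b)) (φ↑ a b a<b))

    τ₀↑ : Increasing τ₀
    τ₀↑ a b a<b = increasing-reflects-< χ₀↑ _ _ (subst₂ Fin._<_ (≡.sym (χ₀τ₀ a)) (≡.sym (χ₀τ₀ b)) (ψ↑ a b a<b))

    J₀ : JointlySurjective σ₀ τ₀
    J₀ a with χ₀-into a
    ... | inj₁ (j , e) = inj₁ (j , increasing⇒injective χ₀↑ _ _ (≡.trans (χ₀σ₀ j) e))
    ... | inj₂ (j , e) = inj₂ (j , increasing⇒injective χ₀↑ _ _ (≡.trans (χ₀τ₀ j) e))

  p₀≤m+k : p₀ ≤ m ℕ.+ k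
  p₀≤m+k = jointlySurjective⇒≤ σ₀ τ₀ J₀

  factorises⇒image : ∀ {p} {σ : Fin m → Fin p} {τ χ} → Factorises φ ψ σ τ χ →
                     p ≡ p₀ × (∀ a a′ → toℕ a ≡ toℕ a′ → χ a ≡ χ₀ a′)
  factorises⇒image {σ = σ} {τ} {χ} ((_ , _ , J) , χ↑ , φ≗ , ψ≗) = increasing-same-image χ↑ χ₀↑ im⊆ im⊇
    where
    im⊆ : ∀ a → ∃ λ b → χ a ≡ χ₀ b
    im⊆ a with J a
    ... | inj₁ (j , e) = let b , χ₀b≡ = χ₀-onto (χ a) (inj₁ (j , ≡.trans (φ≗ j) (cong χ e))) in b , ≡.sym χ₀b≡
    ... | inj₂ (j , e) = let b , χ₀b≡ = χ₀-onto (χ a) (inj₂ (j , ≡.trans (ψ≗ j) (cong χ e))) in b , ≡.sym χ₀b≡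
    im⊇ : ∀ b → ∃ λ a → χ₀ b ≡ χ a
    im⊇ b with χ₀-into b
    ... | inj₁ (j , e) = σ j , ≡.trans (≡.sym e) (φ≗ j)
    ... | inj₂ (j , e) = τ j , ≡.trans (≡.sym e) (ψ≗ j)

  factorises-unique : (σ : Fin m → Fin p₀) (τ : Fin k → Fin p₀) (χ : Fin p₀ → Fin n) →
                      does (factorises? φ ψ σ τ χ) ≡ does (σ ≐ σ₀ ×-dec (τ ≐ τ₀ ×-dec χ ≐ χ₀))
  factorises-unique σ τ χ = does-⇔ (mk⇔ to from) (factorises? φ ψ σ τ χ) (σ ≐ σ₀ ×-dec (τ ≐ τ₀ ×-dec χ ≐ χ₀))
    where
    to : Factorises φ ψ σ τ χ → _
    to fac@(_ , _ , φ≗ , ψ≗) = σ≗ , τ≗ , χ≗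
      where
      χ≗ : ∀ a → χ a ≡ χ₀ a
      χ≗ a = proj₂ (factorises⇒image fac) a a ≡.refl
      σ≗ : ∀ j → σ j ≡ σ₀ j
      σ≗ j = increasing⇒injective χ₀↑ _ _ (≡.trans (≡.sym (χ≗ (σ j))) (≡.trans (≡.sym (φ≗ j)) (≡.sym (χ₀σ₀ j))))
      τ≗ : ∀ j → τ j ≡ τ₀ j
      τ≗ j = increasing⇒injective χ₀↑ _ _ (≡.trans (≡.sym (χ≗ (τ j))) (≡.trans (≡.sym (ψ≗ j)) (≡.sym (χ₀τ₀ j))))
    from : _ → Factorises φ ψ σ τ χ
    from (σ≗ , τ≗ , χ≗) = ((transport↑ σ≗ σ₀↑ , transport↑ τ≗ τ₀↑ , J) , transport↑ χ≗ χ₀↑ ,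
                          (λ j → ≡.trans (≡.sym (χ₀σ₀ j)) (≡.sym (≡.trans (χ≗ (σ j)) (cong χ₀ (σ≗ j))))) ,
                          (λ j → ≡.trans (≡.sym (χ₀τ₀ j)) (≡.sym (≡.trans (χ≗ (τ j)) (cong χ₀ (τ≗ j))))))
      where
      transport↑ : ∀ {q r} {f g : Fin q → Fin r} → (∀ i → f i ≡ g i) → Increasing g → Increasing f
      transport↑ f≗g g↑ a b a<b = subst₂ Fin._<_ (≡.sym (f≗g a)) (≡.sym (f≗g b)) (g↑ a b a<b)
      J : JointlySurjective σ τ
      J a with J₀ a
      ... | inj₁ (j , e) = inj₁ (j , ≡.trans (σ≗ j) e)
      ... | inj₂ (j , e) = inj₂ (j , ≡.trans (τ≗ j) e)

noIsolated-witness : ∀ {m} (A : Mat m) → NoIsolated A → ∀ p → ∃ λ j → (A p j ≢ 0) ⊎ (A j p ≢ 0)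
noIsolated-witness {m} A A-noIso p
  with j , ¬both ← Finₚ.¬∀⟶∃¬ m _ (λ j → (A p j ℕₚ.≟ 0) ×-dec (A j p ℕₚ.≟ 0)) (A-noIso p)
     | A p j ℕₚ.≟ 0
... | no  Apj≢0 = j , inj₁ Apj≢0
... | yes Apj≡0 = j , inj₂ (λ Ajp≡0 → ¬both (Apj≡0 , Ajp≡0))

overlay : ∀ {m k p} (A : Mat m) (B : Mat k) → (Fin m → Fin p) → (Fin k → Fin p) → Mat p
overlay A B σ τ a b = push σ A a b ℕ.+ push τ B a b

module _ {m k p} (A : Mat m) (B : Mat k) (σ : Fin m → Fin p) (τ : Fin k → Fin p) where

  private
    ≤-overlayˡ : ∀ j l → A j l ≤ overlay A B σ τ (σ j) (σ l)
    ≤-overlayˡ j l = ℕₚ.≤-trans (≤-push σ A j l) (ℕₚ.m≤m+n _ _)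

    ≤-overlayʳ : ∀ j l → B j l ≤ overlay A B σ τ (τ j) (τ l)
    ≤-overlayʳ j l = ℕₚ.≤-trans (≤-push τ B j l) (ℕₚ.m≤n+m _ _)

    ≤-0 : ∀ {x y} → x ≤ y → y ≡ 0 → x ≡ 0
    ≤-0 x≤y y≡0 = ℕₚ.n≤0⇒n≡0 (ℕₚ.≤-trans x≤y (ℕₚ.≤-reflexive y≡0))

  overlay-noIsolated : JointlySurjective σ τ → NoIsolated A → NoIsolated B → NoIsolated (overlay A B σ τ)
  overlay-noIsolated J A-noIso B-noIso a all0 with J a
  ... | inj₁ (j , ≡.refl) with noIsolated-witness A A-noIso j
  ... | l , inj₁ Ajl≢0 = Ajl≢0 (≤-0 (≤-overlayˡ j l) (proj₁ (all0 (σ l))))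
  ... | l , inj₂ Alj≢0 = Alj≢0 (≤-0 (≤-overlayˡ l j) (proj₂ (all0 (σ l))))
  overlay-noIsolated J A-noIso B-noIso a all0 | inj₂ (j , ≡.refl) with noIsolated-witness B B-noIso j
  ... | l , inj₁ Bjl≢0 = Bjl≢0 (≤-0 (≤-overlayʳ j l) (proj₁ (all0 (τ l))))
  ... | l , inj₂ Blj≢0 = Blj≢0 (≤-0 (≤-overlayʳ l j) (proj₂ (all0 (τ l))))

  overlay-symmetric : Symmetric A → Symmetric B → Symmetric (overlay A B σ τ)
  overlay-symmetric A-sym B-sym a b = cong₂ ℕ._+_ (push-symmetric σ A A-sym a b) (push-symmetric τ B B-sym a b)

  overlay-zeroDiagonal : Increasing σ → Increasing τ → ZeroDiagonal A → ZeroDiagonal B → ZeroDiagonal (overlay A B σ τ)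
  overlay-zeroDiagonal σ↑ τ↑ A-zd B-zd a =
    cong₂ ℕ._+_ (push-zeroDiagonal σ A (increasing⇒injective σ↑) A-zd a) (push-zeroDiagonal τ B (increasing⇒injective τ↑) B-zd a)

noIsolated-push⇒onto : ∀ {m m′} {A : Mat m} (H : Mat m′) → NoIsolated A → (φ : Fin m′ → Fin m) →
                       (∀ p q → A p q ≡ push φ H p q) → Onto φ
noIsolated-push⇒onto {A = A} H A-noIso φ A≗ p with noIsolated-witness A A-noIso p
... | j , inj₁ Apj≢0 = let j₀ , _ , φj₀≡p , _ = push-nonzero φ H p j (λ e → Apj≢0 (≡.trans (A≗ p j) e)) in j₀ , φj₀≡p
... | j , inj₂ Ajp≢0 = let _ , k₀ , _ , φk₀≡p = push-nonzero φ H j p (λ e → Ajp≢0 (≡.trans (A≗ j p) e)) in k₀ , φk₀≡p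

SameAdj : ∀ {m m′} → Mat m → Mat m′ → Set
SameAdj {m} {m′} A B = Σ (m ≡ m′) λ { ≡.refl → ∀ p q → A p q ≡ B p q }

sameAdj⇒≗ : ∀ {m} {A B : Mat m} → SameAdj A B → ∀ p q → A p q ≡ B p q
sameAdj⇒≗ (e , A≗B) rewrite ℕₚ.≡-irrelevant e ≡.refl = A≗B

sameAdj? : ∀ {m m′} (A : Mat m) (B : Mat m′) → Dec (SameAdj A B)
sameAdj? {m} {m′} A B with m ℕₚ.≟ m′
... | yes ≡.refl = Dec.map′ (≡.refl ,_) sameAdj⇒≗ (all? (λ p → all? (λ q → A p q ℕₚ.≟ B p q)))
... | no  m≢m′   = no (λ e → m≢m′ (proj₁ e))

sameAdj-sym : ∀ {m m′} {A : Mat m} {B : Mat m′} → SameAdj A B → SameAdj B A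
sameAdj-sym (≡.refl , A≗B) = ≡.refl , λ p q → ≡.sym (A≗B p q)

sameAdj-trans : ∀ {m m′ m″} {A : Mat m} {B : Mat m′} {C : Mat m″} → SameAdj A B → SameAdj B C → SameAdj A C
sameAdj-trans (≡.refl , A≗B) (≡.refl , B≗C) = ≡.refl , λ p q → ≡.trans (A≗B p q) (B≗C p q)

sameGraph? : Graph → Graph → Bool
sameGraph? G H = does (sameAdj? (Graph.adj G) (Graph.adj H))

module _ {m} (A : Mat m) where

  entry-symmetric : Symmetric A → ∀ a b → entry A a b ≡ entry A b a
  entry-symmetric A-sym a b with a ℕ.<? m | b ℕ.<? m
  ... | yes _ | yes _ = A-sym _ _
  ... | yes _ | no  _ = ≡.refl
  ... | no  _ | yes _ = ≡.refl
  ... | no  _ | no  _ = ≡.refl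

  entry-zeroDiagonal : ZeroDiagonal A → ∀ a → entry A a a ≡ 0
  entry-zeroDiagonal A-zd a with a ℕ.<? m
  ... | yes _ = A-zd _
  ... | no  _ = ≡.refl

  entry-fromℕ< : ∀ {a b} (a<m : a < m) (b<m : b < m) → entry A a b ≡ A (fromℕ< a<m) (fromℕ< b<m)
  entry-fromℕ< {a} {b} a<m b<m with a ℕ.<? m | b ℕ.<? m
  ... | yes _   | yes _   = ≡.refl
  ... | no  a≮m | _       = ⊥-elim (a≮m a<m)
  ... | yes _   | no  b≮m = ⊥-elim (b≮m b<m)

entry-cong : ∀ {m} {A B : Mat m} → (∀ p q → A p q ≡ B p q) → ∀ a b → entry A a b ≡ entry B a b
entry-cong {m} A≗B a b with a ℕ.<? m | b ℕ.<? m
... | yes _ | yes _ = A≗B _ _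
... | yes _ | no  _ = ≡.refl
... | no  _ | _     = ≡.refl

Admissible : ∀ {m} → Mat m → ℕ → Set
Admissible {m} A i = ∀ (j k : Fin m) → toℕ j < i → i ≤ toℕ k → (A j k ≡ 0) × (A k j ≡ 0)

admissible?-cong : ∀ {m} {A B : Mat m} → (∀ p q → A p q ≡ B p q) → ∀ i → admissible? A i ≡ admissible? B i
admissible?-cong A≗B i = does-⇔ (mk⇔ (transport A≗B) (transport (λ p q → ≡.sym (A≗B p q)))) (all? _) (all? _)
  where
  transport : ∀ {A B : Mat _} → (∀ p q → A p q ≡ B p q) → Admissible A i → Admissible B i
  transport A≗B cut j k j<i i≤k = subst₂ (λ x y → (x ≡ 0) × (y ≡ 0)) (A≗B j k) (A≗B k j) (cut j k j<i i≤k)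

-- restrictL i and restrictR i are the blocks with lo = 0 and lo = i.
block : ∀ {m} (A : Mat m) lo len → Mat len
block A lo len p q = entry A (lo ℕ.+ toℕ p) (lo ℕ.+ toℕ q)

block-noIsolated : ∀ {m} (A : Mat m) lo len → lo ℕ.+ len ≤ m → Admissible A lo → Admissible A (lo ℕ.+ len) →
                   NoIsolated A → NoIsolated (block A lo len)
block-noIsolated {m} A lo len lo+len≤m lo-cut hi-cut A-noIso p all0 = no-edge (noIsolated-witness A A-noIso v)
  where
  lo+p<hi : lo ℕ.+ toℕ p < lo ℕ.+ len
  lo+p<hi = ℕₚ.+-monoʳ-< lo (toℕ<n p)
  v<m : lo ℕ.+ toℕ p < m
  v<m = ℕₚ.<-≤-trans lo+p<hi lo+len≤m
  v : Fin m
  v = fromℕ< v<m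
  toℕv : toℕ v ≡ lo ℕ.+ toℕ p
  toℕv = toℕ-fromℕ< v<m
  no-edge : (∃ λ j → (A v j ≢ 0) ⊎ (A j v ≢ 0)) → ⊥
  no-edge (j , edge) with toℕ j ℕ.<? lo | toℕ j ℕ.<? lo ℕ.+ len
  ... | yes j<lo | _ = [ (λ ne → ne (proj₂ cut)) , (λ ne → ne (proj₁ cut)) ]′ edge
    where cut = lo-cut j v j<lo (subst (lo ≤_) (≡.sym toℕv) (ℕₚ.m≤m+n lo (toℕ p)))
  ... | no _ | no j≮hi = [ (λ ne → ne (proj₁ cut)) , (λ ne → ne (proj₂ cut)) ]′ edge
    where cut = hi-cut v j (subst (_< lo ℕ.+ len) (≡.sym toℕv) lo+p<hi) (ℕₚ.≮⇒≥ j≮hi)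
  ... | no j≮lo | yes j<hi = [ (λ ne → ne (≡.trans (≡.sym block-pq) (proj₁ (all0 q)))) ,
                                (λ ne → ne (≡.trans (≡.sym block-qp) (proj₂ (all0 q)))) ]′ edge
    where
    lo≤j : lo ≤ toℕ j
    lo≤j = ℕₚ.≮⇒≥ j≮lo
    q<len : toℕ j ∸ lo < len
    q<len = ℕₚ.+-cancelˡ-< lo _ _ (subst (_< lo ℕ.+ len) (≡.sym (ℕₚ.m+[n∸m]≡n lo≤j)) j<hi)
    q : Fin len
    q = fromℕ< q<len
    lo+q≡j : lo ℕ.+ toℕ q ≡ toℕ j
    lo+q≡j = ≡.trans (cong (lo ℕ.+_) (toℕ-fromℕ< q<len)) (ℕₚ.m+[n∸m]≡n lo≤j)
    lo+q<m : lo ℕ.+ toℕ q < m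
    lo+q<m = subst (_< m) (≡.sym lo+q≡j) (toℕ<n j)
    j≡ : fromℕ< lo+q<m ≡ j
    j≡ = toℕ-injective (≡.trans (toℕ-fromℕ< lo+q<m) lo+q≡j)
    block-pq : block A lo len p q ≡ A v j
    block-pq = ≡.trans (entry-fromℕ< A v<m lo+q<m) (cong (A v) j≡)
    block-qp : block A lo len q p ≡ A j v
    block-qp = ≡.trans (entry-fromℕ< A lo+q<m v<m) (cong (λ x → A x v) j≡)

restrictL-noIsolated : ∀ {m} (A : Mat m) i → i ≤ m → Admissible A i → NoIsolated A → NoIsolated (restrictL i A)
restrictL-noIsolated A i i≤m i-cut = block-noIsolated A 0 i i≤m (λ _ _ ()) i-cut

restrictR-noIsolated : ∀ {m} (A : Mat m) i → i ≤ m → Admissible A i → NoIsolated A → NoIsolated (restrictR i A)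
restrictR-noIsolated {m} A i i≤m i-cut =
  block-noIsolated A i (m ∸ i) (ℕₚ.≤-reflexive (ℕₚ.m+[n∸m]≡n i≤m)) i-cut
    (λ j k _ m≤k → ⊥-elim (ℕₚ.<⇒≱ (toℕ<n k) (subst (_≤ toℕ k) (ℕₚ.m+[n∸m]≡n i≤m) m≤k)))

∈-cuts⇒ : ∀ {m} {A : Mat m} {i} → i ∈ cuts A → i ≤ m × Admissible A i
∈-cuts⇒ {m} {A} i∈ = let i∈upTo , cut = ∈-filter⁻ (λ i → T? (admissible? A i)) {xs = upTo (suc m)} i∈
                      in ℕₚ.≤-pred (∈-upTo⁻ i∈upTo) , T-does⇒ (all? _) cut

∈-properCuts⇒ : ∀ {m} {A : Mat m} {i} → i ∈ properCuts A → i ≤ m × Admissible A i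
∈-properCuts⇒ {m} {A} i∈ = let i∈upTo , cut = ∈-filter⁻ (λ i → T? (admissible? A i)) {xs = upTo m} i∈
                            in ℕₚ.<⇒≤ (∈-upTo⁻ i∈upTo) , T-does⇒ (all? _) cut

cuts-cong : ∀ {m} {A B : Mat m} → (∀ p q → A p q ≡ B p q) → cuts A ≡ cuts B
cuts-cong {m} {A} {B} A≗B = filter-≐ (λ i → T? (admissible? A i)) (λ i → T? (admissible? B i))
  ((λ {i} → subst T (admissible?-cong A≗B i)) , (λ {i} → subst T (≡.sym (admissible?-cong A≗B i)))) (upTo (suc m))

properCuts-cong : ∀ {m} {A B : Mat m} → (∀ p q → A p q ≡ B p q) → properCuts A ≡ properCuts B
properCuts-cong {m} {A} {B} A≗B = filter-≐ (λ i → T? (admissible? A i)) (λ i → T? (admissible? B i))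
  ((λ {i} → subst T (admissible?-cong A≗B i)) , (λ {i} → subst T (≡.sym (admissible?-cong A≗B i)))) (upTo m)

symmetric? : ∀ {m} (A : Mat m) → Dec (Symmetric A)
symmetric? A = all? (λ i → all? (λ j → A i j ℕₚ.≟ A j i))

zeroDiagonal? : ∀ {m} (A : Mat m) → Dec (ZeroDiagonal A)
zeroDiagonal? A = all? (λ i → A i i ℕₚ.≟ 0)

symmetric-resp : ∀ {m} {A B : Mat m} → (∀ p q → A p q ≡ B p q) → Symmetric A → Symmetric B
symmetric-resp A≗B A-sym p q = ≡.trans (≡.sym (A≗B p q)) (≡.trans (A-sym p q) (A≗B q p))

zeroDiagonal-resp : ∀ {m} {A B : Mat m} → (∀ p q → A p q ≡ B p q) → ZeroDiagonal A → ZeroDiagonal B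
zeroDiagonal-resp A≗B A-zd p = ≡.trans (≡.sym (A≗B p p)) (A-zd p)

module _ {m} (A : Mat m) (i : ℕ) where

  restrictL-symmetric : Symmetric A → Symmetric (restrictL i A)
  restrictL-symmetric A-sym p q = entry-symmetric A A-sym (toℕ p) (toℕ q)

  restrictR-symmetric : Symmetric A → Symmetric (restrictR i A)
  restrictR-symmetric A-sym p q = entry-symmetric A A-sym (i ℕ.+ toℕ p) (i ℕ.+ toℕ q)

  restrictL-zeroDiagonal : ZeroDiagonal A → ZeroDiagonal (restrictL i A)
  restrictL-zeroDiagonal A-zd p = entry-zeroDiagonal A A-zd (toℕ p)

  restrictR-zeroDiagonal : ZeroDiagonal A → ZeroDiagonal (restrictR i A)
  restrictR-zeroDiagonal A-zd p = entry-zeroDiagonal A A-zd (i ℕ.+ toℕ p)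

record GraphClass : Set₁ where
  field
    Holds            : ∀ {m} → Mat m → Set
    holds?           : ∀ {m} (A : Mat m) → Dec (Holds A)
    resp             : ∀ {m} {A B : Mat m} → (∀ p q → A p q ≡ B p q) → Holds A → Holds B
    empty            : Holds {0} (λ ())
    overlay-closed   : ∀ {m k p} (A : Mat m) (B : Mat k) (σ : Fin m → Fin p) (τ : Fin k → Fin p) →
                       QuasiShuffle σ τ → Holds A → Holds B → Holds (overlay A B σ τ)
    restrictL-closed : ∀ {m} (A : Mat m) i → Holds A → Holds (restrictL i A)
    restrictR-closed : ∀ {m} (A : Mat m) i → Holds A → Holds (restrictR i A)

_∩ᶜ_ : GraphClass → GraphClass → GraphClass
𝒞 ∩ᶜ 𝒟 = record
  { Holds            = λ A → C.Holds A × D.Holds A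
  ; holds?           = λ A → C.holds? A ×-dec D.holds? A
  ; resp             = λ A≗B (c , d) → C.resp A≗B c , D.resp A≗B d
  ; empty            = C.empty , D.empty
  ; overlay-closed   = λ A B σ τ qs (c , d) (c′ , d′) → C.overlay-closed A B σ τ qs c c′ , D.overlay-closed A B σ τ qs d d′
  ; restrictL-closed = λ A i (c , d) → C.restrictL-closed A i c , D.restrictL-closed A i d
  ; restrictR-closed = λ A i (c , d) → C.restrictR-closed A i c , D.restrictR-closed A i d
  }
  where
  module C = GraphClass 𝒞
  module D = GraphClass 𝒟

symmetricGraphs : GraphClass
symmetricGraphs = record
  { Holds            = Symmetric
  ; holds?           = symmetric?
  ; resp             = symmetric-resp
  ; empty            = λ ()
  ; overlay-closed   = λ A B σ τ _ → overlay-symmetric A B σ τ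
  ; restrictL-closed = restrictL-symmetric
  ; restrictR-closed = restrictR-symmetric
  }

zeroDiagonalGraphs : GraphClass
zeroDiagonalGraphs = record
  { Holds            = ZeroDiagonal
  ; holds?           = zeroDiagonal?
  ; resp             = zeroDiagonal-resp
  ; empty            = λ ()
  ; overlay-closed   = λ A B σ τ (σ↑ , τ↑ , _) → overlay-zeroDiagonal A B σ τ σ↑ τ↑
  ; restrictL-closed = restrictL-zeroDiagonal
  ; restrictR-closed = restrictR-zeroDiagonal
  }

-- The product formula

module Series {c ℓ} (F : Field c ℓ) where
  open Field F
  open FiniteSum commutativeSemiring
  open GQSym F
  open import Relation.Binary.Reasoning.Setoid setoid

  ∑-maps-≐ : ∀ m n (g : Fin m → Fin n) (h : (Fin m → Fin n) → Carrier) → (∀ f → (∀ i → f i ≡ g i) → h f ≈ h g) →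
             ∑ (maps m n) (λ f → [ does (f ≐ g) ] h f) ≈ h g
  ∑-maps-≐ m n g h h-resp =
    trans (allFuns-enumerates (λ _ → ≡.refl) _≟F_ m _ _ (λ _ → allFin-enumerates n) g h h-resp) ([]-true _ (allᵇ-const m g))

  ∑-maps-≐-1 : ∀ m n (g : Fin m → Fin n) → ∑ (maps m n) (λ f → [ does (f ≐ g) ] 1#) ≈ 1#
  ∑-maps-≐-1 m n g = ∑-maps-≐ m n g (λ _ → 1#) (λ _ _ → refl)

  𝕄-as-∑ : ∀ {m} (A : Mat m) n e → 𝕄 A (n , e) ≈ ∑ (maps m n) (λ φ → [ increasing? φ ] [ sameMat? e (push φ A) ] 1#)
  𝕄-as-∑ {m} A n e = trans (∑-cong (filterᵇ increasing? (maps m n)) (λ φ → sym ([]-unfold _ _))) (∑-filter (λ φ → T? (increasing? φ)) (maps m n) _)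

  module _ {m k n} {φ : Fin m → Fin n} {ψ : Fin k → Fin n} (φ↑ : Increasing φ) (ψ↑ : Increasing ψ) where
    open Factorisation φ↑ ψ↑

    #factorisations : ℕ → Carrier
    #factorisations p = ∑ (maps m p) λ σ → ∑ (maps k p) λ τ → ∑ (maps p n) λ χ → [ does (factorises? φ ψ σ τ χ) ] 1#

    private
      #factorisations-p₀ : #factorisations p₀ ≈ 1#
      #factorisations-p₀ = begin
        #factorisations p₀
          ≈⟨ ∑-cong (maps m p₀) (λ σ → ∑-cong (maps k p₀) (λ τ → ∑-cong (maps p₀ n) (λ χ →
               trans ([]-congᵇ 1# (factorises-unique σ τ χ)) (trans ([]-∧ _ _ _) ([]-cong (does (σ ≐ σ₀)) ([]-∧ _ _ _)))))) ⟩
        ∑ (maps m p₀) (λ σ → ∑ (maps k p₀) (λ τ → ∑ (maps p₀ n) (λ χ → [ does (σ ≐ σ₀) ] [ does (τ ≐ τ₀) ] [ does (χ ≐ χ₀) ] 1#)))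
          ≈⟨ ∑-cong (maps m p₀) (λ σ → trans (∑-cong (maps k p₀) (λ τ → ∑-[] (does (σ ≐ σ₀)) (maps p₀ n) _))
                                              (∑-[] (does (σ ≐ σ₀)) (maps k p₀) _)) ⟩
        ∑ (maps m p₀) (λ σ → [ does (σ ≐ σ₀) ] ∑ (maps k p₀) (λ τ → ∑ (maps p₀ n) (λ χ → [ does (τ ≐ τ₀) ] [ does (χ ≐ χ₀) ] 1#)))
          ≈⟨ ∑-cong (maps m p₀) (λ σ → []-cong (does (σ ≐ σ₀)) (trans (∑-cong (maps k p₀) (λ τ → ∑-[] (does (τ ≐ τ₀)) (maps p₀ n) _))
                                                                        (∑-maps-≐ k p₀ τ₀ _ (λ _ _ → refl)))) ⟩
        ∑ (maps m p₀) (λ σ → [ does (σ ≐ σ₀) ] ∑ (maps p₀ n) (λ χ → [ does (χ ≐ χ₀) ] 1#))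
          ≈⟨ ∑-cong (maps m p₀) (λ σ → []-cong (does (σ ≐ σ₀)) (∑-maps-≐-1 p₀ n χ₀)) ⟩
        ∑ (maps m p₀) (λ σ → [ does (σ ≐ σ₀) ] 1#)
          ≈⟨ ∑-maps-≐-1 m p₀ σ₀ ⟩
        1# ∎

      #factorisations-only-p₀ : ∀ p → #factorisations p ≈ [ does (p ≟ℕ p₀) ] #factorisations p
      #factorisations-only-p₀ p with p ≟ℕ p₀
      ... | yes p≡p₀ = sym ([]-true _ (dec-true (p ≟ℕ p₀) p≡p₀))
      ... | no  p≢p₀ = trans (∑-zero (maps m p) λ σ → ∑-zero (maps k p) λ τ → ∑-zero (maps p n) λ χ →
                                []-false _ (dec-false (factorises? φ ψ σ τ χ) (λ fac → p≢p₀ (proj₁ (factorises⇒image fac)))))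
                             (sym ([]-false _ (dec-false (p ≟ℕ p₀) p≢p₀)))

    ∑-#factorisations : ∑ (upTo (suc (m ℕ.+ k))) #factorisations ≈ 1#
    ∑-#factorisations = begin
      ∑ (upTo (suc (m ℕ.+ k))) #factorisations                                 ≈⟨ ∑-cong (upTo (suc (m ℕ.+ k))) #factorisations-only-p₀ ⟩
      ∑ (upTo (suc (m ℕ.+ k))) (λ p → [ does (p ≟ℕ p₀) ] #factorisations p)   ≈⟨ upTo-enumerates (m ℕ.+ k) p₀ #factorisations (λ { _ ≡.refl → refl }) ⟩
      [ does (p₀ ℕ.≤? m ℕ.+ k) ] #factorisations p₀                            ≈⟨ []-true _ (dec-true (p₀ ℕ.≤? m ℕ.+ k) p₀≤m+k) ⟩
      #factorisations p₀                                                       ≈⟨ #factorisations-p₀ ⟩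
      1#                                                                       ∎

  module Product {m k} (A : Mat m) (B : Mat k) (n : ℕ) (e : Mat n) where

    Splits : (Fin m → Fin n) → (Fin k → Fin n) → Set
    Splits φ ψ = Increasing φ × Increasing ψ × (∀ p q → e p q ≡ push φ A p q ℕ.+ push ψ B p q)

    splits? : ∀ φ ψ → Dec (Splits φ ψ)
    splits? φ ψ = increasing-dec φ ×-dec (increasing-dec ψ ×-dec all? (λ p → all? (λ q → e p q ≟ℕ push φ A p q ℕ.+ push ψ B p q)))

    splits : (Fin m → Fin n) → (Fin k → Fin n) → Bool
    splits φ ψ = does (splits? φ ψ)

    private
      submatrices : List (Mat n)
      submatrices = allFuns n (λ p → allFuns n (λ q → upTo (suc (e p q))))

      _∸ᴹ_ : Mat n → Mat n → Mat n
      (e₁ ∸ᴹ e₂) p q = e₁ p q ∸ e₂ p q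

      ≤e : Mat n → Bool
      ≤e = allᵇ n (λ p → allᵇ n (λ q x → does (x ℕ.≤? e p q)))

      submatrices-enumerate : ∀ (g : Mat n) (h : Mat n → Carrier) → (∀ a → (∀ p q → a p q ≡ g p q) → h a ≈ h g) →
                              ∑ submatrices (λ a → [ sameMat? a g ] h a) ≈ [ ≤e g ] h g
      submatrices-enumerate = allFuns-enumerates (λ _ _ → ≡.refl) (pointwise? _≟ℕ_) n _ _
                                (λ p → allFuns-enumerates (λ _ → ≡.refl) _≟ℕ_ n _ _ (λ q → upTo-enumerates (e p q)))

      ≤e⇒ : ∀ {P} → ≤e P ≡ true → ∀ p q → P p q ≤ e p q
      ≤e⇒ t p q = does⇒ (_ ℕ.≤? e p q) (allᵇ⇒ n (allᵇ⇒ n t p) q)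

      ⇒≤e : ∀ {P} → (∀ p q → P p q ≤ e p q) → ≤e P ≡ true
      ⇒≤e P≤e = ⇒allᵇ n (λ p → ⇒allᵇ n (λ q → dec-true (_ ℕ.≤? e p q) (P≤e p q)))

      ≤e∧∸≡ : ∀ P Q → (≤e P ∧ sameMat? (e ∸ᴹ P) Q) ≡ sameMat? e (λ p q → P p q ℕ.+ Q p q)
      ≤e∧∸≡ P Q = bool-ext to from
        where
        to : _ → _
        to t = let P≤e , e∸P≡Q = ∧-≡-true t in dec-true (all? _) λ p q →
          ≡.trans (≡.sym (ℕₚ.m+[n∸m]≡n (≤e⇒ P≤e p q))) (cong (P p q ℕ.+_) (sameMat?⇒ e∸P≡Q p q))
        from : _ → _
        from t = ≡-true-∧ (⇒≤e (λ p q → subst (P p q ≤_) (≡.sym (e≡ p q)) (ℕₚ.m≤m+n _ _)))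
                          (dec-true (all? _) (λ p q → ≡.trans (cong (_∸ P p q) (e≡ p q)) (ℕₚ.m+n∸m≡n (P p q) (Q p q))))
          where e≡ = sameMat?⇒ t

      bracket-* : ∀ a b c d → ([ a ] [ b ] 1#) * ([ c ] [ d ] 1#) ≈ [ a ] [ c ] [ b ] [ d ] 1#
      bracket-* a b c d = begin
        ([ a ] [ b ] 1#) * ([ c ] [ d ] 1#)   ≈⟨ []-*ˡ a _ _ ⟩
        [ a ] (([ b ] 1#) * ([ c ] [ d ] 1#)) ≈⟨ []-cong a (trans ([]-*ʳ c _ _) ([]-cong c ([]-*ˡ b _ _))) ⟩
        [ a ] [ c ] [ b ] (1# * [ d ] 1#)     ≈⟨ []-cong a ([]-cong c ([]-cong b (*-identityˡ _))) ⟩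
        [ a ] [ c ] [ b ] [ d ] 1#            ∎

      -- The contribution of (φ, ψ) to the term of x^e′ · x^(e ∸ e′) in 𝕄_A 𝕄_B.
      pieces : Mat n → (Fin m → Fin n) → (Fin k → Fin n) → Carrier
      pieces e′ φ ψ = [ increasing? φ ] [ increasing? ψ ] [ sameMat? e′ (push φ A) ] [ sameMat? (e ∸ᴹ e′) (push ψ B) ] 1#

      product-at : ∀ e′ → 𝕄 A (n , e′) * 𝕄 B (n , e ∸ᴹ e′) ≈ ∑ (maps m n) (λ φ → ∑ (maps k n) (pieces e′ φ))
      product-at e′ = begin
        𝕄 A (n , e′) * 𝕄 B (n , e ∸ᴹ e′)                      ≈⟨ *-cong (𝕄-as-∑ A n e′) (𝕄-as-∑ B n _) ⟩
        ∑ (maps m n) a * ∑ (maps k n) b                       ≈⟨ trans (*-distribʳ-∑ _ (maps m n) a) (∑-cong (maps m n) λ φ → *-distribˡ-∑ _ (maps k n) b) ⟩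
        ∑ (maps m n) (λ φ → ∑ (maps k n) λ ψ → a φ * b ψ)     ≈⟨ ∑-cong (maps m n) (λ φ → ∑-cong (maps k n) λ ψ → bracket-* _ _ _ _) ⟩
        ∑ (maps m n) (λ φ → ∑ (maps k n) (pieces e′ φ))        ∎
        where
        a : (Fin m → Fin n) → Carrier
        a φ = [ increasing? φ ] [ sameMat? e′ (push φ A) ] 1#
        b : (Fin k → Fin n) → Carrier
        b ψ = [ increasing? ψ ] [ sameMat? (e ∸ᴹ e′) (push ψ B) ] 1#

      ∑-submatrices : ∀ φ ψ → ∑ submatrices (λ e′ → pieces e′ φ ψ) ≈ [ splits φ ψ ] 1#
      ∑-submatrices φ ψ = begin
        ∑ submatrices (λ e′ → pieces e′ φ ψ)
          ≈⟨ trans (∑-[] (increasing? φ) submatrices _) ([]-cong (increasing? φ) (∑-[] (increasing? ψ) submatrices _)) ⟩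
        [ increasing? φ ] [ increasing? ψ ] ∑ submatrices (λ e′ → [ sameMat? e′ (push φ A) ] [ sameMat? (e ∸ᴹ e′) (push ψ B) ] 1#)
          ≈⟨ []-cong (increasing? φ) ([]-cong (increasing? ψ) (submatrices-enumerate (push φ A) _
               (λ e′ e′≗ → []-congᵇ 1# (sameMat?-cong (λ p q → cong (e p q ∸_) (e′≗ p q)) (λ _ _ → ≡.refl))))) ⟩
        [ increasing? φ ] [ increasing? ψ ] [ ≤e (push φ A) ] [ sameMat? (e ∸ᴹ push φ A) (push ψ B) ] 1#
          ≈⟨ []-cong (increasing? φ) ([]-cong (increasing? ψ) (trans (sym ([]-∧ _ _ _)) ([]-congᵇ 1# (≤e∧∸≡ (push φ A) (push ψ B))))) ⟩
        [ increasing? φ ] [ increasing? ψ ] [ sameMat? e (λ p q → push φ A p q ℕ.+ push ψ B p q) ] 1#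
          ≈⟨ sym (trans ([]-∧ _ _ _) ([]-cong (increasing? φ) ([]-∧ _ _ _))) ⟩
        [ splits φ ψ ] 1# ∎

    *ₛ-as-∑ : (𝕄 A *ₛ 𝕄 B) (n , e) ≈ ∑ (maps m n) (λ φ → ∑ (maps k n) (λ ψ → [ splits φ ψ ] 1#))
    *ₛ-as-∑ = trans (∑-cong submatrices product-at)
                (trans (∑-comm submatrices (maps m n) _)
                       (∑-cong (maps m n) (λ φ → trans (∑-comm submatrices (maps k n) _) (∑-cong (maps k n) (∑-submatrices φ)))))

    private
      splits-cong : ∀ {φ φ′ ψ ψ′} → (∀ j → φ j ≡ φ′ j) → (∀ j → ψ j ≡ ψ′ j) → splits φ ψ ≡ splits φ′ ψ′
      splits-cong {φ} {φ′} {ψ} {ψ′} φ≗ ψ≗ = does-⇔ (mk⇔ (λ (φ↑ , ψ↑ , e≡) → ↑-cong φ≗ φ↑ , ↑-cong ψ≗ ψ↑ , λ p q → ≡.trans (e≡ p q) (push≡ p q))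
                                      (λ (φ↑ , ψ↑ , e≡) → ↑-cong (λ j → ≡.sym (φ≗ j)) φ↑ , ↑-cong (λ j → ≡.sym (ψ≗ j)) ψ↑ ,
                                                          λ p q → ≡.trans (e≡ p q) (≡.sym (push≡ p q))))
                                 (splits? φ ψ) (splits? φ′ ψ′)
        where
        ↑-cong : ∀ {q r} {f g : Fin q → Fin r} → (∀ i → f i ≡ g i) → Increasing f → Increasing g
        ↑-cong f≗g f↑ a b a<b = subst₂ Fin._<_ (f≗g a) (f≗g b) (f↑ a b a<b)
        push≡ : ∀ p q → push φ A p q ℕ.+ push ψ B p q ≡ push φ′ A p q ℕ.+ push ψ′ B p q
        push≡ p q = cong₂ ℕ._+_ (push-cong-map A φ≗ p q) (push-cong-map B ψ≗ p q)

      splits-through : ∀ {p} {σ : Fin m → Fin p} {τ : Fin k → Fin p} {χ : Fin p → Fin n} → QuasiShuffle σ τ → Increasing χ →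
                       splits (λ j → χ (σ j)) (λ j → χ (τ j)) ≡ sameMat? e (push χ (overlay A B σ τ))
      splits-through {σ = σ} {τ} {χ} (σ↑ , τ↑ , _) χ↑ =
        does-⇔ (mk⇔ (λ (_ , _ , e≡) p q → ≡.trans (e≡ p q) (≡.sym (push-overlay p q)))
                    (λ e≡ → increasing-∘ χ↑ σ↑ , increasing-∘ χ↑ τ↑ , λ p q → ≡.trans (e≡ p q) (push-overlay p q)))
               (splits? _ _) (all? _)
        where
        push-overlay : ∀ p q → push χ (overlay A B σ τ) p q ≡ push (λ j → χ (σ j)) A p q ℕ.+ push (λ j → χ (τ j)) B p q
        push-overlay p q = ≡.trans (push-+ χ (push σ A) (push τ B) p q) (cong₂ ℕ._+_ (push-∘ σ χ A p q) (push-∘ τ χ B p q))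

      ∑-splits-factorises : ∀ {p} (σ : Fin m → Fin p) (τ : Fin k → Fin p) (χ : Fin p → Fin n) →
        ∑ (maps m n) (λ φ → ∑ (maps k n) (λ ψ → [ splits φ ψ ] [ does (factorises? φ ψ σ τ χ) ] 1#)) ≈
        [ does (quasiShuffle? σ τ) ] [ increasing? χ ] [ sameMat? e (push χ (overlay A B σ τ)) ] 1#
      ∑-splits-factorises σ τ χ = begin
        ∑ (maps m n) (λ φ → ∑ (maps k n) (λ ψ → [ splits φ ψ ] [ does (factorises? φ ψ σ τ χ) ] 1#))
          ≈⟨ ∑-cong (maps m n) (λ φ → ∑-cong (maps k n) (λ ψ → reorder (splits φ ψ) (does (φ ≐ χσ)) (does (ψ ≐ χτ)))) ⟩
        ∑ (maps m n) (λ φ → ∑ (maps k n) (λ ψ → [ does (φ ≐ χσ) ] [ does (ψ ≐ χτ) ] H φ ψ))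
          ≈⟨ ∑-cong (maps m n) (λ φ → trans (∑-[] (does (φ ≐ χσ)) (maps k n) _)
               ([]-cong (does (φ ≐ χσ)) (∑-maps-≐ k n χτ (H φ) (λ ψ ψ≗ → H-cong (λ _ → ≡.refl) ψ≗)))) ⟩
        ∑ (maps m n) (λ φ → [ does (φ ≐ χσ) ] H φ χτ)
          ≈⟨ ∑-maps-≐ m n χσ (λ φ → H φ χτ) (λ φ φ≗ → H-cong φ≗ (λ _ → ≡.refl)) ⟩
        H χσ χτ
          ≈⟨ trans ([]-comm _ _ _) ([]-cong qs ([]-comm _ _ _)) ⟩
        [ qs ] [ increasing? χ ] [ splits χσ χτ ] 1#
          ≈⟨ []-congᵗ qs (λ qs≡true → []-congᵗ (increasing? χ) (λ χ↑≡true →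
               []-congᵇ 1# (splits-through (does⇒ (quasiShuffle? σ τ) qs≡true) (does⇒ (increasing-dec χ) χ↑≡true)))) ⟩
        [ qs ] [ increasing? χ ] [ sameMat? e (push χ (overlay A B σ τ)) ] 1# ∎
        where
        qs : Bool
        qs = does (quasiShuffle? σ τ)
        χσ : Fin m → Fin n
        χσ j = χ (σ j)
        χτ : Fin k → Fin n
        χτ j = χ (τ j)
        H : (Fin m → Fin n) → (Fin k → Fin n) → Carrier
        H φ ψ = [ splits φ ψ ] [ qs ] [ increasing? χ ] 1#
        H-cong : ∀ {φ φ′ ψ ψ′} → (∀ j → φ j ≡ φ′ j) → (∀ j → ψ j ≡ ψ′ j) → H φ ψ ≈ H φ′ ψ′
        H-cong φ≗ ψ≗ = []-congᵇ _ (splits-cong φ≗ ψ≗)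
        reorder : ∀ s a b → [ s ] [ qs ∧ (increasing? χ ∧ (a ∧ b)) ] 1# ≈ [ a ] [ b ] [ s ] [ qs ] [ increasing? χ ] 1#
        reorder s a b = begin
          [ s ] [ qs ∧ (increasing? χ ∧ (a ∧ b)) ] 1#    ≈⟨ []-cong s (trans ([]-∧ _ _ _) ([]-cong qs (trans ([]-∧ _ _ _) ([]-cong _ ([]-∧ a b _))))) ⟩
          [ s ] [ qs ] [ increasing? χ ] [ a ] [ b ] 1#  ≈⟨ []-cong s ([]-cong qs (trans ([]-comm _ a _) ([]-cong a ([]-comm _ b _)))) ⟩
          [ s ] [ qs ] [ a ] [ b ] [ increasing? χ ] 1#  ≈⟨ []-cong s (trans ([]-comm qs a _) ([]-cong a ([]-comm qs b _))) ⟩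
          [ s ] [ a ] [ b ] [ qs ] [ increasing? χ ] 1#  ≈⟨ trans ([]-comm s a _) ([]-cong a ([]-comm s b _)) ⟩
          [ a ] [ b ] [ s ] [ qs ] [ increasing? χ ] 1#  ∎

      ∑-comm-factorisations : ∀ {a} {X : Set a} (l : List X) (f : X → ∀ p → (Fin m → Fin p) → (Fin k → Fin p) → (Fin p → Fin n) → Carrier) →
        ∑ l (λ x → ∑ (upTo (suc (m ℕ.+ k))) λ p → ∑ (maps m p) λ σ → ∑ (maps k p) λ τ → ∑ (maps p n) λ χ → f x p σ τ χ) ≈
        ∑ (upTo (suc (m ℕ.+ k))) (λ p → ∑ (maps m p) λ σ → ∑ (maps k p) λ τ → ∑ (maps p n) λ χ → ∑ l λ x → f x p σ τ χ)
      ∑-comm-factorisations l f =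
        trans (∑-comm l (upTo (suc (m ℕ.+ k))) _) (∑-cong (upTo (suc (m ℕ.+ k))) λ p →
        trans (∑-comm l (maps m p) _) (∑-cong (maps m p) λ σ →
        trans (∑-comm l (maps k p) _) (∑-cong (maps k p) λ τ → ∑-comm l (maps p n) _)))

    𝕄-*ₛ-𝕄 : (𝕄 A *ₛ 𝕄 B) (n , e) ≈
      ∑ (upTo (suc (m ℕ.+ k))) (λ p → ∑ (maps m p) λ σ → ∑ (maps k p) λ τ → [ does (quasiShuffle? σ τ) ] 𝕄 (overlay A B σ τ) (n , e))
    𝕄-*ₛ-𝕄 = begin
      (𝕄 A *ₛ 𝕄 B) (n , e)
        ≈⟨ *ₛ-as-∑ ⟩
      ∑ (maps m n) (λ φ → ∑ (maps k n) λ ψ → [ splits φ ψ ] 1#)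
        ≈⟨ ∑-cong (maps m n) (λ φ → ∑-cong (maps k n) λ ψ → []-congᵗ (splits φ ψ) λ t →
             let φ↑ , ψ↑ , _ = does⇒ (splits? φ ψ) t in sym (∑-#factorisations φ↑ ψ↑)) ⟩
      ∑ (maps m n) (λ φ → ∑ (maps k n) λ ψ → [ splits φ ψ ] ∑ (upTo (suc (m ℕ.+ k))) λ p →
          ∑ (maps m p) λ σ → ∑ (maps k p) λ τ → ∑ (maps p n) λ χ → [ does (factorises? φ ψ σ τ χ) ] 1#)
        ≈⟨ ∑-cong (maps m n) (λ φ → ∑-cong (maps k n) λ ψ → let b = splits φ ψ in
             trans (sym (∑-[] b (upTo (suc (m ℕ.+ k))) _)) (∑-cong (upTo (suc (m ℕ.+ k))) λ p →
             trans (sym (∑-[] b (maps m p) _)) (∑-cong (maps m p) λ σ →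
             trans (sym (∑-[] b (maps k p) _)) (∑-cong (maps k p) λ τ → sym (∑-[] b (maps p n) _))))) ⟩
      ∑ (maps m n) (λ φ → ∑ (maps k n) λ ψ → ∑ (upTo (suc (m ℕ.+ k))) λ p →
          ∑ (maps m p) λ σ → ∑ (maps k p) λ τ → ∑ (maps p n) λ χ → [ splits φ ψ ] [ does (factorises? φ ψ σ τ χ) ] 1#)
        ≈⟨ trans (∑-cong (maps m n) (λ φ → ∑-comm-factorisations (maps k n) _)) (∑-comm-factorisations (maps m n) _) ⟩
      ∑ (upTo (suc (m ℕ.+ k))) (λ p → ∑ (maps m p) λ σ → ∑ (maps k p) λ τ → ∑ (maps p n) λ χ →
          ∑ (maps m n) λ φ → ∑ (maps k n) λ ψ → [ splits φ ψ ] [ does (factorises? φ ψ σ τ χ) ] 1#)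
        ≈⟨ ∑-cong (upTo (suc (m ℕ.+ k))) (λ p → ∑-cong (maps m p) λ σ → ∑-cong (maps k p) λ τ →
             trans (∑-cong (maps p n) (∑-splits-factorises σ τ))
                   (trans (∑-[] (does (quasiShuffle? σ τ)) (maps p n) _) ([]-cong _ (sym (𝕄-as-∑ (overlay A B σ τ) n e))))) ⟩
      ∑ (upTo (suc (m ℕ.+ k))) (λ p → ∑ (maps m p) λ σ → ∑ (maps k p) λ τ → [ does (quasiShuffle? σ τ) ] 𝕄 (overlay A B σ τ) (n , e)) ∎

  -- An increasing φ with A = push φ H is onto, as A has no isolated vertex, hence the identity.
  𝕄-at-graph : ∀ {m′ m} (H : Mat m′) (A : Mat m) → NoIsolated A → 𝕄 H (m , A) ≈ [ does (sameAdj? H A) ] 1#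
  𝕄-at-graph {m′} {m} H A A-noIso = by-size (m′ ℕₚ.≟ m)
    where
    by-size : Dec (m′ ≡ m) → 𝕄 H (m , A) ≈ [ does (sameAdj? H A) ] 1#
    by-size (no m′≢m) = trans (𝕄-as-∑ H m A) (trans (∑-zero (maps m′ m) λ φ → trans (sym ([]-∧ _ _ _))
                    ([]-false _ (dec-false (increasing-dec φ ×-dec all? _) λ (φ↑ , A≗) →
                       m′≢m (increasing-onto⇒≡ φ↑ (noIsolated-push⇒onto H A-noIso φ A≗)))))
                    (sym ([]-false _ (dec-false (sameAdj? H A) (λ e → m′≢m (proj₁ e))))))
    by-size (yes ≡.refl) = trans (𝕄-as-∑ H m A) (trans (∑-cong (maps m m) λ φ →
                       trans (sym ([]-∧ _ _ _)) (trans ([]-congᵇ 1# (only-identity φ)) ([]-∧ _ _ _)))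
                       (trans (∑-maps-≐ m m (λ j → j) _ (λ _ _ → refl))
                              ([]-congᵇ 1# (does-⇔ (mk⇔ (≡.refl ,_) sameAdj⇒≗) (all? _) (sameAdj? H A)))))
      where
      only-identity : ∀ φ → (increasing? φ ∧ sameMat? A (push φ H)) ≡ (does (φ ≐ (λ j → j)) ∧ sameMat? H A)
      only-identity φ = does-⇔ (mk⇔ to from) (increasing-dec φ ×-dec all? _) ((φ ≐ (λ j → j)) ×-dec all? _)
        where
        push-id′ : (∀ j → φ j ≡ j) → ∀ p q → push φ H p q ≡ H p q
        push-id′ φ≗id p q = ≡.trans (push-cong-map H φ≗id p q) (push-id H p q)
        to : Increasing φ × (∀ p q → A p q ≡ push φ H p q) → (∀ j → φ j ≡ j) × (∀ p q → H p q ≡ A p q)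
        to (φ↑ , A≗) = φ≗id , λ p q → ≡.sym (≡.trans (A≗ p q) (push-id′ φ≗id p q))
          where
          φ≗id : ∀ j → φ j ≡ j
          φ≗id j = toℕ-injective (increasing-onto-fixes φ↑ (noIsolated-push⇒onto H A-noIso φ A≗) j)
        from : (∀ j → φ j ≡ j) × (∀ p q → H p q ≡ A p q) → Increasing φ × (∀ p q → A p q ≡ push φ H p q)
        from (φ≗id , H≗A) = (λ a b a<b → subst₂ Fin._<_ (≡.sym (φ≗id a)) (≡.sym (φ≗id b)) a<b) ,
                            λ p q → ≡.trans (≡.sym (H≗A p q)) (≡.sym (push-id′ φ≗id p q))

  eval-as-∑ : ∀ (r : Comb) μ → eval r μ ≈ ∑ r (λ cG → proj₁ cG * 𝕄 (Graph.adj (proj₂ cG)) μ)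
  eval-as-∑ []      μ = refl
  eval-as-∑ (x ∷ r) μ = +-congˡ (eval-as-∑ r μ)

  coefficient : Comb → Graph → Carrier
  coefficient r G = ∑ r (λ cH → proj₁ cH * [ sameGraph? (proj₂ cH) G ] 1#)

  eval-at-graph : ∀ (r : Comb) (G : Graph) → eval r (Graph.m G , Graph.adj G) ≈ coefficient r G
  eval-at-graph r G = trans (eval-as-∑ r _) (∑-cong r λ cH → *-congˡ (𝕄-at-graph (Graph.adj (proj₂ cH)) (Graph.adj G) (Graph.noIso G)))

  module _ (f : Graph → Carrier) (f-resp : ∀ G H → SameAdj (Graph.adj G) (Graph.adj H) → f G ≈ f H) where

    private
      term : Carrier × Graph → Carrier
      term cG = proj₁ cG * f (proj₂ cG)

      other? : ∀ G (cH : Carrier × Graph) → Dec (¬ SameAdj (Graph.adj (proj₂ cH)) (Graph.adj G))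
      other? G cH = ¬? (sameAdj? (Graph.adj (proj₂ cH)) (Graph.adj G))

      ∑-same : ∀ G (r : Comb) → ∑ r (λ cH → [ sameGraph? (proj₂ cH) G ] term cH) ≈ coefficient r G * f G
      ∑-same G r = begin
        ∑ r (λ cH → [ sameGraph? (proj₂ cH) G ] term cH)
          ≈⟨ ∑-cong r (λ cH → []-congᵗ (sameGraph? (proj₂ cH) G) λ t → *-congˡ (f-resp _ _ (does⇒ (sameAdj? _ _) t))) ⟩
        ∑ r (λ cH → [ sameGraph? (proj₂ cH) G ] (proj₁ cH * f G))
          ≈⟨ ∑-cong r (λ cH → sym (trans (*-congʳ ([]-*1 _ _)) ([]-*ˡ _ _ _))) ⟩
        ∑ r (λ cH → (proj₁ cH * [ sameGraph? (proj₂ cH) G ] 1#) * f G)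
          ≈⟨ sym (*-distribʳ-∑ (f G) r _) ⟩
        coefficient r G * f G ∎

      coefficient-filter : ∀ G (r : Comb) H → coefficient (filter (other? G) r) H ≈ [ not (sameGraph? H G) ] coefficient r H
      coefficient-filter G r H = begin
        coefficient (filter (other? G) r) H
          ≈⟨ ∑-filter (other? G) r _ ⟩
        ∑ r (λ cK → [ not (sameGraph? (proj₂ cK) G) ] (proj₁ cK * [ sameGraph? (proj₂ cK) H ] 1#))
          ≈⟨ ∑-cong r (λ cK → trans (sym ([]-*ʳ _ _ _)) (*-congˡ (bracket cK))) ⟩
        ∑ r (λ cK → proj₁ cK * [ not (sameGraph? H G) ] [ sameGraph? (proj₂ cK) H ] 1#)
          ≈⟨ trans (∑-cong r (λ cK → []-*ʳ _ _ _)) (∑-[] _ r _) ⟩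
        [ not (sameGraph? H G) ] coefficient r H ∎
        where
        bracket : ∀ cK → [ not (sameGraph? (proj₂ cK) G) ] [ sameGraph? (proj₂ cK) H ] 1# ≈
                         [ not (sameGraph? H G) ] [ sameGraph? (proj₂ cK) H ] 1#
        bracket cK with sameAdj? (Graph.adj (proj₂ cK)) (Graph.adj H)
        ... | yes K~H = []-congᵇ _ (cong not (does-⇔ (mk⇔ (sameAdj-trans (sameAdj-sym K~H)) (sameAdj-trans K~H)) (sameAdj? _ _) (sameAdj? _ _)))
        ... | no  _   = trans (vanish _) (sym (vanish _))
          where
          vanish : ∀ b → [ b ] [ false ] 1# ≈ 0#
          vanish b = trans ([]-cong b ([]-false 1# ≡.refl)) ([]-0 b)

    ∑-coefficients-vanish : ∀ n (r : Comb) → length r ≤ n → (∀ G → coefficient r G ≈ 0# ⊎ f G ≈ 0#) → ∑ r term ≈ 0#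
    ∑-coefficients-vanish _       []            _           _    = refl
    ∑-coefficients-vanish (suc n) (cG@(_ , G) ∷ r) (s≤s |r|≤n) hyp = begin
      term cG + ∑ r term
        ≈⟨ +-congˡ (trans (∑-cong r λ cH → []-split (sameGraph? (proj₂ cH) G) (term cH)) (∑-+ r _ _)) ⟩
      term cG + (∑ r (λ cH → [ sameGraph? (proj₂ cH) G ] term cH) + ∑ r (λ cH → [ not (sameGraph? (proj₂ cH) G) ] term cH))
        ≈⟨ trans (sym (+-assoc _ _ _)) (+-cong (+-congʳ (sym ([]-true _ (dec-true (sameAdj? (Graph.adj G) (Graph.adj G)) (≡.refl , λ _ _ → ≡.refl)))))
                                               (sym (∑-filter (other? G) r term))) ⟩
      ∑ (cG ∷ r) (λ cH → [ sameGraph? (proj₂ cH) G ] term cH) + ∑ (filter (other? G) r) term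
        ≈⟨ +-cong (trans (∑-same G (cG ∷ r)) (vanishes (hyp G)))
                  (∑-coefficients-vanish n (filter (other? G) r) (ℕₚ.≤-trans (length-filter (other? G) r) |r|≤n) hyp′) ⟩
      0# + 0#
        ≈⟨ +-identityˡ 0# ⟩
      0# ∎
      where
      vanishes : coefficient (cG ∷ r) G ≈ 0# ⊎ f G ≈ 0# → coefficient (cG ∷ r) G * f G ≈ 0#
      vanishes (inj₁ c≈0) = trans (*-congʳ c≈0) (zeroˡ _)
      vanishes (inj₂ f≈0) = trans (*-congˡ f≈0) (zeroʳ _)
      coefficient-rest : ∀ H → coefficient (filter (other? G) r) H ≈ [ not (sameGraph? H G) ] coefficient (cG ∷ r) H
      coefficient-rest H = begin
        coefficient (filter (other? G) r) H
          ≈⟨ reflexive (cong (λ l → coefficient l H) (≡.sym (filter-reject (other? G) (λ ¬G~G → ¬G~G (≡.refl , λ _ _ → ≡.refl))))) ⟩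
        coefficient (filter (other? G) (cG ∷ r)) H
          ≈⟨ coefficient-filter G (cG ∷ r) H ⟩
        [ not (sameGraph? H G) ] coefficient (cG ∷ r) H ∎
      hyp′ : ∀ H → coefficient (filter (other? G) r) H ≈ 0# ⊎ f H ≈ 0#
      hyp′ H with hyp H
      ... | inj₁ c≈0 = inj₁ (trans (coefficient-rest H) (trans ([]-cong _ c≈0) ([]-0 _)))
      ... | inj₂ f≈0 = inj₂ f≈0

  eval-++ : ∀ (r s : Comb) μ → eval (r ++ s) μ ≈ eval r μ + eval s μ
  eval-++ r s μ = trans (eval-as-∑ (r ++ s) μ) (trans (∑-++ r s _) (sym (+-cong (eval-as-∑ r μ) (eval-as-∑ s μ))))

  scale : Carrier → Comb → Comb
  scale a = map (λ cG → a * proj₁ cG , proj₂ cG)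

  eval-scale : ∀ a (r : Comb) μ → eval (scale a r) μ ≈ a * eval r μ
  eval-scale a r μ = begin
    eval (scale a r) μ                                      ≈⟨ trans (eval-as-∑ (scale a r) μ) (∑-map r _ _) ⟩
    ∑ r (λ cG → (a * proj₁ cG) * 𝕄 (Graph.adj (proj₂ cG)) μ) ≈⟨ ∑-cong r (λ _ → *-assoc _ _ _) ⟩
    ∑ r (λ cG → a * (proj₁ cG * 𝕄 (Graph.adj (proj₂ cG)) μ)) ≈⟨ sym (trans (*-congˡ (eval-as-∑ r μ)) (*-distribˡ-∑ a r _)) ⟩
    a * eval r μ                                            ∎

  *ₛ-cong : ∀ {f f′ g g′} → f ≈ₛ f′ → g ≈ₛ g′ → (f *ₛ g) ≈ₛ (f′ *ₛ g′)
  *ₛ-cong f≈f′ g≈g′ (n , e) = ∑-cong (allFuns n (λ p → allFuns n (λ q → upTo (suc (e p q))))) (λ _ → *-cong (f≈f′ _) (g≈g′ _))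

  eval-*ₛ-eval : ∀ (r s : Comb) μ → (eval r *ₛ eval s) μ ≈
    ∑ r (λ cG → ∑ s (λ cH → (proj₁ cG * proj₁ cH) * (𝕄 (Graph.adj (proj₂ cG)) *ₛ 𝕄 (Graph.adj (proj₂ cH))) μ))
  eval-*ₛ-eval r s (n , e) = begin
    ∑ E (λ e′ → eval r (n , e′) * eval s (n , e ∸ᴹ e′))
      ≈⟨ ∑-cong E (λ e′ → trans (*-cong (eval-as-∑ r _) (eval-as-∑ s _)) (trans (*-distribʳ-∑ _ r _) (∑-cong r λ _ →
           trans (*-distribˡ-∑ _ s _) (∑-cong s λ _ → interchange _ _ _ _)))) ⟩
    ∑ E (λ e′ → ∑ r (λ cG → ∑ s (λ cH → (proj₁ cG * proj₁ cH) * (𝕄 (Graph.adj (proj₂ cG)) (n , e′) * 𝕄 (Graph.adj (proj₂ cH)) (n , e ∸ᴹ e′)))))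
      ≈⟨ trans (∑-comm E r _) (∑-cong r λ _ → trans (∑-comm E s _) (∑-cong s λ _ → sym (*-distribˡ-∑ _ E _))) ⟩
    ∑ r (λ cG → ∑ s (λ cH → (proj₁ cG * proj₁ cH) * (𝕄 (Graph.adj (proj₂ cG)) *ₛ 𝕄 (Graph.adj (proj₂ cH))) (n , e))) ∎
    where
    E : List (Mat n)
    E = allFuns n (λ p → allFuns n (λ q → upTo (suc (e p q))))
    _∸ᴹ_ : Mat n → Mat n → Mat n
    (e₁ ∸ᴹ e₂) p q = e₁ p q ∸ e₂ p q
    interchange : ∀ a b u v → (a * u) * (b * v) ≈ (a * b) * (u * v)
    interchange a b u v = begin
      (a * u) * (b * v) ≈⟨ *-assoc a u (b * v) ⟩
      a * (u * (b * v)) ≈⟨ *-congˡ (trans (sym (*-assoc u b v)) (trans (*-congʳ (*-comm u b)) (*-assoc b u v))) ⟩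
      a * (b * (u * v)) ≈⟨ sym (*-assoc a b (u * v)) ⟩
      (a * b) * (u * v) ∎

  module _ (G H : Graph) where
    private
      m : ℕ
      m = Graph.m G
      k : ℕ
      k = Graph.m H
      A : Mat m
      A = Graph.adj G
      B : Mat k
      B = Graph.adj H

      overlayTerm : ∀ {p} (σ : Fin m → Fin p) (τ : Fin k → Fin p) → Dec (QuasiShuffle σ τ) → Comb
      overlayTerm {p} σ τ (yes (_ , _ , J)) = (1# , graph p (overlay A B σ τ) (overlay-noIsolated A B σ τ J (Graph.noIso G) (Graph.noIso H))) ∷ []
      overlayTerm σ τ (no _) = []

      overlayTerm-eval : ∀ {p} (σ : Fin m → Fin p) (τ : Fin k → Fin p) (d : Dec (QuasiShuffle σ τ)) μ →
        ∑ (overlayTerm σ τ d) (λ cK → proj₁ cK * 𝕄 (Graph.adj (proj₂ cK)) μ) ≈ [ does d ] 𝕄 (overlay A B σ τ) μ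
      overlayTerm-eval σ τ (yes _) μ = trans (+-identityʳ _) (trans (*-identityˡ _) (sym ([]-true _ ≡.refl)))
      overlayTerm-eval σ τ (no _)  μ = sym ([]-false _ ≡.refl)

    quasiShuffleProduct : Comb
    quasiShuffleProduct = concatMap (λ p → concatMap (λ σ → concatMap (λ τ → overlayTerm σ τ (quasiShuffle? σ τ)) (maps k p)) (maps m p))
                                    (upTo (suc (m ℕ.+ k)))

    eval-quasiShuffleProduct : eval quasiShuffleProduct ≈ₛ (𝕄 A *ₛ 𝕄 B)
    eval-quasiShuffleProduct (n , e) = begin
      eval quasiShuffleProduct (n , e)
        ≈⟨ eval-as-∑ quasiShuffleProduct _ ⟩
      ∑ quasiShuffleProduct term
        ≈⟨ trans (∑-concatMap (upTo (suc (m ℕ.+ k))) terms term) (∑-cong (upTo (suc (m ℕ.+ k))) λ p →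
           trans (∑-concatMap (maps m p) (termsσ p) term) (∑-cong (maps m p) λ σ →
           trans (∑-concatMap (maps k p) (λ τ → overlayTerm σ τ (quasiShuffle? σ τ)) term) (∑-cong (maps k p) λ τ →
             overlayTerm-eval σ τ (quasiShuffle? σ τ) (n , e)))) ⟩
      ∑ (upTo (suc (m ℕ.+ k))) (λ p → ∑ (maps m p) λ σ → ∑ (maps k p) λ τ → [ does (quasiShuffle? σ τ) ] 𝕄 (overlay A B σ τ) (n , e))
        ≈⟨ sym (Product.𝕄-*ₛ-𝕄 A B n e) ⟩
      (𝕄 A *ₛ 𝕄 B) (n , e) ∎
      where
      term : Carrier × Graph → Carrier
      term cK = proj₁ cK * 𝕄 (Graph.adj (proj₂ cK)) (n , e)
      termsσ : ∀ p → (Fin m → Fin p) → Comb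
      termsσ p σ = concatMap (λ τ → overlayTerm σ τ (quasiShuffle? σ τ)) (maps k p)
      terms : ℕ → Comb
      terms p = concatMap (termsσ p) (maps m p)

    quasiShuffleProduct-closed : ∀ {q} (Q : ∀ {m} → Mat m → Set q) →
      (∀ {p} (σ : Fin m → Fin p) (τ : Fin k → Fin p) → QuasiShuffle σ τ → Q A → Q B → Q (overlay A B σ τ)) →
      Q A → Q B → All (λ cK → Q (Graph.adj (proj₂ cK))) quasiShuffleProduct
    quasiShuffleProduct-closed Q Q-overlay QA QB =
      concatMap-All (upTo (suc (m ℕ.+ k))) λ p → concatMap-All (maps m p) λ σ →
        concatMap-All (maps k p) {λ τ → overlayTerm σ τ (quasiShuffle? σ τ)} λ τ → closed σ τ (quasiShuffle? σ τ)
      where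
      concatMap-All : ∀ {a b p} {X : Set a} {Y : Set b} {P : Y → Set p} (l : List X) {f : X → List Y} → (∀ x → All P (f x)) → All P (concatMap f l)
      concatMap-All l Pf = All.concat⁺ (All.map⁺ {xs = l} (All.tabulate (λ {x} _ → Pf x)))
      closed : ∀ {p} (σ : Fin m → Fin p) (τ : Fin k → Fin p) (d : Dec (QuasiShuffle σ τ)) → All (λ cK → Q (Graph.adj (proj₂ cK))) (overlayTerm σ τ d)
      closed σ τ (yes qs) = Q-overlay σ τ qs QA QB ∷ []
      closed σ τ (no _)   = []

  _⊛_ : Comb → Comb → Comb
  r ⊛ s = concatMap (λ cG → concatMap (λ cH → scale (proj₁ cG * proj₁ cH) (quasiShuffleProduct (proj₂ cG) (proj₂ cH))) s) r

  eval-⊛ : ∀ r s → (eval r *ₛ eval s) ≈ₛ eval (r ⊛ s)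
  eval-⊛ r s μ = begin
    (eval r *ₛ eval s) μ
      ≈⟨ eval-*ₛ-eval r s μ ⟩
    ∑ r (λ cG → ∑ s (λ cH → (proj₁ cG * proj₁ cH) * (𝕄 (Graph.adj (proj₂ cG)) *ₛ 𝕄 (Graph.adj (proj₂ cH))) μ))
      ≈⟨ ∑-cong r (λ cG → ∑-cong s λ cH → trans (*-congˡ (sym (eval-quasiShuffleProduct (proj₂ cG) (proj₂ cH) μ)))
           (trans (sym (eval-scale _ (quasiShuffleProduct (proj₂ cG) (proj₂ cH)) μ))
                  (eval-as-∑ (scale (proj₁ cG * proj₁ cH) (quasiShuffleProduct (proj₂ cG) (proj₂ cH))) μ))) ⟩
    ∑ r (λ cG → ∑ s (λ cH → ∑ (scale (proj₁ cG * proj₁ cH) (quasiShuffleProduct (proj₂ cG) (proj₂ cH))) term))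
      ≈⟨ sym (trans (∑-concatMap r _ term) (∑-cong r λ cG → ∑-concatMap s _ term)) ⟩
    ∑ (r ⊛ s) term
      ≈⟨ sym (eval-as-∑ (r ⊛ s) μ) ⟩
    eval (r ⊛ s) μ ∎
    where
    term : Carrier × Graph → Carrier
    term cK = proj₁ cK * 𝕄 (Graph.adj (proj₂ cK)) μ

  𝕄-cong : ∀ {m} {A B : Mat m} → (∀ p q → A p q ≡ B p q) → 𝕄 A ≈ₛ 𝕄 B
  𝕄-cong {m} {A} {B} A≗B (n , e) = trans (𝕄-as-∑ A n e) (trans (∑-cong (maps m n) λ φ →
    []-cong (increasing? φ) ([]-congᵇ 1# (sameMat?-cong (λ _ _ → ≡.refl) (push-cong φ A≗B)))) (sym (𝕄-as-∑ B n e)))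

  sumₛ-as-∑ : ∀ (l : List Series) μ → sumₛ l μ ≈ ∑ l (λ f → f μ)
  sumₛ-as-∑ []      μ = refl
  sumₛ-as-∑ (f ∷ l) μ = +-congˡ (sumₛ-as-∑ l μ)

  sumₜ-as-∑ : ∀ (l : List TSeries) μ ν → sumₜ l μ ν ≈ ∑ l (λ t → t μ ν)
  sumₜ-as-∑ []      μ ν = refl
  sumₜ-as-∑ (t ∷ l) μ ν = +-congˡ (sumₜ-as-∑ l μ ν)

  Δ𝕄-as-∑ : ∀ {m} (A : Mat m) μ ν → Δ𝕄 A μ ν ≈ ∑ (cuts A) (λ i → 𝕄 (restrictL i A) μ * 𝕄 (restrictR i A) ν)
  Δ𝕄-as-∑ A μ ν = trans (sumₜ-as-∑ (map tensor (cuts A)) μ ν) (∑-map (cuts A) tensor (λ t → t μ ν))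
    where
    tensor : ℕ → TSeries
    tensor i = 𝕄 (restrictL i A) ⊗ 𝕄 (restrictR i A)

  Δ-as-∑ : ∀ (r : Comb) μ ν → Δ r μ ν ≈ ∑ r (λ cG → proj₁ cG * Δ𝕄 (Graph.adj (proj₂ cG)) μ ν)
  Δ-as-∑ r μ ν = trans (sumₜ-as-∑ (map term r) μ ν) (∑-map r term (λ t → t μ ν))
    where
    term : Carrier × Graph → TSeries
    term cG μ ν = proj₁ cG * Δ𝕄 (Graph.adj (proj₂ cG)) μ ν

  S-as-∑ : ∀ (r : Comb) μ → S r μ ≈ ∑ r (λ cG → proj₁ cG * S𝕄 (Graph.adj (proj₂ cG)) μ)
  S-as-∑ r μ = trans (sumₛ-as-∑ (map term r) μ) (∑-map r term (λ f → f μ))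
    where
    term : Carrier × Graph → Series
    term cG = proj₁ cG ·ₛ S𝕄 (Graph.adj (proj₂ cG))

  module _ {m} {A B : Mat m} (A≗B : ∀ p q → A p q ≡ B p q) where

    private
      restrictL-cong : ∀ i p q → restrictL i A p q ≡ restrictL i B p q
      restrictL-cong i p q = entry-cong A≗B (toℕ p) (toℕ q)

      restrictR-cong : ∀ i p q → restrictR i A p q ≡ restrictR i B p q
      restrictR-cong i p q = entry-cong A≗B (i ℕ.+ toℕ p) (i ℕ.+ toℕ q)

    Δ𝕄-cong : ∀ μ ν → Δ𝕄 A μ ν ≈ Δ𝕄 B μ ν
    Δ𝕄-cong μ ν = begin
      Δ𝕄 A μ ν                                                              ≈⟨ Δ𝕄-as-∑ A μ ν ⟩
      ∑ (cuts A) (λ i → 𝕄 (restrictL i A) μ * 𝕄 (restrictR i A) ν)          ≈⟨ reflexive (cong (λ l → ∑ l _) (cuts-cong A≗B)) ⟩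
      ∑ (cuts B) (λ i → 𝕄 (restrictL i A) μ * 𝕄 (restrictR i A) ν)          ≈⟨ ∑-cong (cuts B) (λ i → *-cong (𝕄-cong (restrictL-cong i) μ)
                                                                                                                (𝕄-cong (restrictR-cong i) ν)) ⟩
      ∑ (cuts B) (λ i → 𝕄 (restrictL i B) μ * 𝕄 (restrictR i B) ν)          ≈⟨ sym (Δ𝕄-as-∑ B μ ν) ⟩
      Δ𝕄 B μ ν                                                              ∎

  S𝕄′-cong : ∀ fuel {m} {A B : Mat m} → (∀ p q → A p q ≡ B p q) → S𝕄′ fuel A ≈ₛ S𝕄′ fuel B
  S𝕄′-cong zero                 A≗B μ = refl
  S𝕄′-cong (suc fuel) {zero}    A≗B μ = refl
  S𝕄′-cong (suc fuel) {suc m} {A} {B} A≗B μ = -‿cong (begin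
    sumₛ (map (term A) (properCuts A)) μ        ≈⟨ trans (sumₛ-as-∑ (map (term A) (properCuts A)) μ) (∑-map (properCuts A) (term A) (λ f → f μ)) ⟩
    ∑ (properCuts A) (λ i → term A i μ)         ≈⟨ reflexive (cong (λ l → ∑ l (λ i → term A i μ)) (properCuts-cong A≗B)) ⟩
    ∑ (properCuts B) (λ i → term A i μ)         ≈⟨ ∑-cong (properCuts B) (λ i →
                                                     *ₛ-cong (S𝕄′-cong fuel {A = restrictL i A} (λ p q → entry-cong A≗B (toℕ p) (toℕ q)))
                                                             (𝕄-cong {A = restrictR i A} (λ p q → entry-cong A≗B (i ℕ.+ toℕ p) (i ℕ.+ toℕ q))) μ) ⟩
    ∑ (properCuts B) (λ i → term B i μ)         ≈⟨ sym (trans (sumₛ-as-∑ (map (term B) (properCuts B)) μ) (∑-map (properCuts B) (term B) (λ f → f μ))) ⟩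
    sumₛ (map (term B) (properCuts B)) μ        ∎)
    where
    term : Mat (suc m) → ℕ → Series
    term C i = S𝕄′ fuel (restrictL i C) *ₛ 𝕄 (restrictR i C)

  sameAdj-resp : (f : Graph → Carrier) →
    (∀ {m} {A B : Mat m} A-noIso B-noIso → (∀ p q → A p q ≡ B p q) → f (graph m A A-noIso) ≈ f (graph m B B-noIso)) →
    ∀ G H → SameAdj (Graph.adj G) (Graph.adj H) → f G ≈ f H
  sameAdj-resp f f-cong (graph m A A-noIso) (graph .m B B-noIso) (≡.refl , A≗B) = f-cong A-noIso B-noIso A≗B

  -- Hopf subalgebras spanned by classes of graphs

  module ClassOfGraphs (𝒞 : GraphClass) where
    open GraphClass 𝒞

    private
      in𝒞 : Graph → Bool
      in𝒞 G = does (holds? (Graph.adj G))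

    ∑-restrict : (f : Graph → Carrier) →
      (∀ {m} {A B : Mat m} A-noIso B-noIso → (∀ p q → A p q ≡ B p q) → f (graph m A A-noIso) ≈ f (graph m B B-noIso)) →
      ∀ (r : Comb) → (∀ G → ¬ Holds (Graph.adj G) → coefficient r G ≈ 0#) →
      ∑ r (λ cG → proj₁ cG * f (proj₂ cG)) ≈ ∑ r (λ cG → proj₁ cG * [ in𝒞 (proj₂ cG) ] f (proj₂ cG))
    ∑-restrict f f-cong r outside≈0 = begin
      ∑ r (λ cG → proj₁ cG * f (proj₂ cG))
        ≈⟨ ∑-cong r (λ cG → trans (*-congˡ ([]-split (in𝒞 (proj₂ cG)) _)) (distribˡ _ _ _)) ⟩
      ∑ r (λ cG → proj₁ cG * [ in𝒞 (proj₂ cG) ] f (proj₂ cG) + proj₁ cG * f′ (proj₂ cG))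
        ≈⟨ ∑-+ r _ _ ⟩
      ∑ r (λ cG → proj₁ cG * [ in𝒞 (proj₂ cG) ] f (proj₂ cG)) + ∑ r (λ cG → proj₁ cG * f′ (proj₂ cG))
        ≈⟨ +-congˡ (∑-coefficients-vanish f′ f′-resp (length r) r ℕₚ.≤-refl outside) ⟩
      ∑ r (λ cG → proj₁ cG * [ in𝒞 (proj₂ cG) ] f (proj₂ cG)) + 0#
        ≈⟨ +-identityʳ _ ⟩
      ∑ r (λ cG → proj₁ cG * [ in𝒞 (proj₂ cG) ] f (proj₂ cG)) ∎
      where
      f′ : Graph → Carrier
      f′ G = [ not (in𝒞 G) ] f G
      f′-resp : ∀ G H → SameAdj (Graph.adj G) (Graph.adj H) → f′ G ≈ f′ H
      f′-resp = sameAdj-resp f′ λ A-noIso B-noIso A≗B →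
        trans ([]-cong _ (f-cong A-noIso B-noIso A≗B))
              ([]-congᵇ _ (cong not (does-⇔ (mk⇔ (resp A≗B) (resp (λ p q → ≡.sym (A≗B p q)))) (holds? _) (holds? _))))
      outside : ∀ G → coefficient r G ≈ 0# ⊎ f′ G ≈ 0#
      outside G with holds? (Graph.adj G)
      ... | yes _  = inj₂ ([]-false _ ≡.refl)
      ... | no  ¬𝒞 = inj₁ (outside≈0 G ¬𝒞)

    module _ (V : Series → Set (c ⊔ ℓ)) (V-𝕄 : ∀ G → Holds (Graph.adj G) → V (𝕄 (Graph.adj G))) where

      private
        Term : Set (c ⊔ ℓ)
        Term = Carrier × Σ Series V × Σ Series V

        ⟦_⟧ : Term → TSeries
        ⟦ a , (x , _) , (y , _) ⟧ μ ν = a * (x ⊗ y) μ ν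

        cutTerms : (cG : Carrier × Graph) → Dec (Holds (Graph.adj (proj₂ cG))) → List Term
        cutTerms (c₀ , graph m A A-noIso) (yes 𝒞A) = mapWith∈ (cuts A) λ {i} i∈ →
          let i≤m , cut = ∈-cuts⇒ i∈ in
          c₀ , (𝕄 (restrictL i A) , V-𝕄 (graph i (restrictL i A) (restrictL-noIsolated A i i≤m cut A-noIso)) (restrictL-closed A i 𝒞A))
             , (𝕄 (restrictR i A) , V-𝕄 (graph (m ∸ i) (restrictR i A) (restrictR-noIsolated A i i≤m cut A-noIso)) (restrictR-closed A i 𝒞A))
        cutTerms _ (no _) = []

        ∑-cutTerms : ∀ cG d μ ν → ∑ (cutTerms cG d) (λ w → ⟦ w ⟧ μ ν) ≈ proj₁ cG * [ does d ] Δ𝕄 (Graph.adj (proj₂ cG)) μ ν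
        ∑-cutTerms (c₀ , graph m A A-noIso) (yes 𝒞A) μ ν = begin
          ∑ (cutTerms (c₀ , graph m A A-noIso) (yes 𝒞A)) (λ w → ⟦ w ⟧ μ ν)
            ≈⟨ ∑-mapWith∈ (cuts A) _ _ _ (λ _ → refl) ⟩
          ∑ (cuts A) (λ i → c₀ * (𝕄 (restrictL i A) μ * 𝕄 (restrictR i A) ν))
            ≈⟨ sym (*-distribˡ-∑ c₀ (cuts A) _) ⟩
          c₀ * ∑ (cuts A) (λ i → 𝕄 (restrictL i A) μ * 𝕄 (restrictR i A) ν)
            ≈⟨ *-congˡ (sym (trans ([]-true _ ≡.refl) (Δ𝕄-as-∑ A μ ν))) ⟩
          c₀ * [ true ] Δ𝕄 A μ ν ∎
        ∑-cutTerms (c₀ , G) (no _) μ ν = sym (trans (*-congˡ ([]-false _ ≡.refl)) (zeroʳ _))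

      Δ-in-span : ∀ (r : Comb) → (∀ G → ¬ Holds (Graph.adj G) → coefficient r G ≈ 0#) → TensorSq V (Δ r)
      Δ-in-span r outside≈0 = terms , λ μ ν → begin
        Δ r μ ν
          ≈⟨ Δ-as-∑ r μ ν ⟩
        ∑ r (λ cG → proj₁ cG * Δ𝕄 (Graph.adj (proj₂ cG)) μ ν)
          ≈⟨ ∑-restrict (λ G → Δ𝕄 (Graph.adj G) μ ν) (λ _ _ A≗B → Δ𝕄-cong A≗B μ ν) r outside≈0 ⟩
        ∑ r (λ cG → proj₁ cG * [ in𝒞 (proj₂ cG) ] Δ𝕄 (Graph.adj (proj₂ cG)) μ ν)
          ≈⟨ ∑-cong r (λ cG → sym (∑-cutTerms cG (holds? (Graph.adj (proj₂ cG))) μ ν)) ⟩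
        ∑ r (λ cG → ∑ (cutTerms cG (holds? (Graph.adj (proj₂ cG)))) (λ w → ⟦ w ⟧ μ ν))
          ≈⟨ sym (∑-concatMap r (λ cG → cutTerms cG (holds? (Graph.adj (proj₂ cG)))) (λ w → ⟦ w ⟧ μ ν)) ⟩
        ∑ terms (λ w → ⟦ w ⟧ μ ν)
          ≈⟨ sym (trans (sumₜ-as-∑ (map ⟦_⟧ terms) μ ν) (∑-map terms ⟦_⟧ (λ t → t μ ν))) ⟩
        sumₜ (map ⟦_⟧ terms) μ ν ∎
        where
        terms : List Term
        terms = concatMap (λ cG → cutTerms cG (holds? (Graph.adj (proj₂ cG)))) r

  module SpanOfClass (𝒞 : GraphClass) where
    open GraphClass 𝒞

    open ClassOfGraphs 𝒞

    V : Series → Set (c ⊔ ℓ)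
    V = Span Holds

    V-resp : ∀ x y → x ≈ₛ y → V x → V y
    V-resp x y x≈y (r , r∈𝒞 , x≈r) = r , r∈𝒞 , λ μ → trans (sym (x≈y μ)) (x≈r μ)

    V-0 : V 0ₛ
    V-0 = [] , [] , λ _ → refl

    V-+ : ∀ x y → V x → V y → V (x +ₛ y)
    V-+ x y (r , r∈𝒞 , x≈r) (s , s∈𝒞 , y≈s) = r ++ s , All.++⁺ r∈𝒞 s∈𝒞 , λ μ → trans (+-cong (x≈r μ) (y≈s μ)) (sym (eval-++ r s μ))

    V-· : ∀ a x → V x → V (a ·ₛ x)
    V-· a x (r , r∈𝒞 , x≈r) = scale a r , All.map⁺ r∈𝒞 , λ μ → trans (*-congˡ (x≈r μ)) (sym (eval-scale a r μ))

    V-- : ∀ x → V x → V (-ₛ x)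
    V-- x v = V-resp _ _ (λ μ → -1*x≈-x (x μ)) (V-· (- 1#) x v)
      where open import Algebra.Properties.Ring ring using (-1*x≈-x)

    V-𝕄 : ∀ G → Holds (Graph.adj G) → V (𝕄 (Graph.adj G))
    V-𝕄 G PG = (1# , G) ∷ [] , PG ∷ [] , λ _ → sym (trans (+-identityʳ _) (*-identityˡ _))

    V-1 : V 1ₛ
    V-1 = V-resp _ _ 𝕄-empty (V-𝕄 (graph 0 (λ ()) (λ ())) empty)
      where
      𝕄-empty : 𝕄 {0} (λ ()) ≈ₛ 1ₛ
      𝕄-empty (n , e) = trans (𝕄-as-∑ {0} (λ ()) n e)
        (trans (+-identityʳ _) (trans ([]-true _ (dec-true (increasing-dec {0} {n} (λ ())) (λ ()))) ([]-unfold _ 1#)))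

    V-* : ∀ x y → V x → V y → V (x *ₛ y)
    V-* x y (r , r∈𝒞 , x≈r) (s , s∈𝒞 , y≈s) = r ⊛ s , concatMap⁺ r∈𝒞 (λ PG → concatMap⁺ s∈𝒞 (λ PH →
        All.map⁺ (quasiShuffleProduct-closed _ _ Holds (λ σ τ → overlay-closed _ _ σ τ) PG PH))) ,
      λ μ → trans (*ₛ-cong x≈r y≈s μ) (eval-⊛ r s μ)
      where
      concatMap⁺ : ∀ {a b p r} {X : Set a} {Y : Set b} {R : X → Set r} {Q : Y → Set p} {l : List X} {f : X → List Y} →
                   All R l → (∀ {x} → R x → All Q (f x)) → All Q (concatMap f l)
      concatMap⁺ Rl RQ = All.concat⁺ (All.map⁺ (All.map RQ Rl))

    coefficient-outside : ∀ x (r : Comb) → x ≈ₛ eval r → V x → ∀ G → ¬ Holds (Graph.adj G) → coefficient r G ≈ 0#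
    coefficient-outside x r x≈r (s , s∈𝒞 , x≈s) G ¬PG = begin
      coefficient r G                  ≈⟨ sym (eval-at-graph r G) ⟩
      eval r (Graph.m G , Graph.adj G) ≈⟨ trans (sym (x≈r _)) (x≈s _) ⟩
      eval s (Graph.m G , Graph.adj G) ≈⟨ eval-at-graph s G ⟩
      coefficient s G                  ≈⟨ coefficient-zero s s∈𝒞 ⟩
      0#                               ∎
      where
      coefficient-zero : ∀ (s : Comb) → All (λ cH → Holds (Graph.adj (proj₂ cH))) s → coefficient s G ≈ 0#
      coefficient-zero [] [] = refl
      coefficient-zero ((c , H) ∷ s) (PH ∷ s∈𝒞) = trans (+-cong (trans ([]-*1 _ c) ([]-false _ (dec-false (sameAdj? _ _) H≁G))) (coefficient-zero s s∈𝒞))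
                                                (+-identityˡ 0#)
        where
        H≁G : ¬ SameAdj (Graph.adj H) (Graph.adj G)
        H≁G H~G = ¬PG (transport H~G PH)
          where
          transport : ∀ {m m′} {A : Mat m} {B : Mat m′} → SameAdj A B → Holds A → Holds B
          transport (≡.refl , A≗B) = resp A≗B

    V-S𝕄′ : ∀ fuel {m} (A : Mat m) → NoIsolated A → Holds A → V (S𝕄′ fuel A)
    V-S𝕄′ zero          A _ _ = V-1
    V-S𝕄′ (suc _) {zero} A _ _ = V-1
    V-S𝕄′ (suc fuel) {suc m} A A-noIso PA = V-- _ (V-sum (properCuts A) λ {i} i∈ →
      let i≤m , cut = ∈-properCuts⇒ i∈ in
      V-* _ _ (V-S𝕄′ fuel _ (restrictL-noIsolated A i i≤m cut A-noIso) (restrictL-closed A i PA))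
              (V-𝕄 (graph _ _ (restrictR-noIsolated A i i≤m cut A-noIso)) (restrictR-closed A i PA)))
      where
      V-sum : ∀ {g : ℕ → Series} l → (∀ {i} → i ∈ l → V (g i)) → V (sumₛ (map g l))
      V-sum []      Vg = V-0
      V-sum (i ∷ l) Vg = V-+ _ _ (Vg (here ≡.refl)) (V-sum l (λ i∈l → Vg (there i∈l)))

    hopfSubalgebra : IsHopfSubalgebra V
    hopfSubalgebra = record
      { sub      = λ x (r , _ , x≈r) → r , All.universal (λ _ → tt) r , x≈r
      ; resp     = V-resp
      ; zero∈    = V-0
      ; +-closed = V-+
      ; ·-closed = V-·
      ; one∈     = V-1
      ; *-closed = V-*
      ; Δ-closed = λ x r x≈r v → Δ-in-span V V-𝕄 r (coefficient-outside x r x≈r v)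
      ; S-closed = λ x r x≈r v → V-resp _ _ (λ μ → sym (S≈ r (coefficient-outside x r x≈r v) μ)) (V-S r)
      }
      where
      in𝒞 : Graph → Bool
      in𝒞 G = does (holds? (Graph.adj G))
      S≈ : ∀ r → (∀ G → ¬ Holds (Graph.adj G) → coefficient r G ≈ 0#) →
           S r ≈ₛ (λ μ → ∑ r (λ cG → proj₁ cG * [ in𝒞 (proj₂ cG) ] S𝕄 (Graph.adj (proj₂ cG)) μ))
      S≈ r outside≈0 μ = trans (S-as-∑ r μ)
        (∑-restrict (λ G → S𝕄 (Graph.adj G) μ) (λ {m} _ _ A≗B → S𝕄′-cong (suc m) A≗B μ) r outside≈0)
      V-S : ∀ r → V (λ μ → ∑ r (λ cG → proj₁ cG * [ in𝒞 (proj₂ cG) ] S𝕄 (Graph.adj (proj₂ cG)) μ))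
      V-S []            = V-0
      V-S ((c₀ , G) ∷ r) = V-+ _ _ (V-· c₀ _ (V-[]S𝕄 (holds? (Graph.adj G)))) (V-S r)
        where
        V-[]S𝕄 : (d : Dec (Holds (Graph.adj G))) → V (λ μ → [ does d ] S𝕄 (Graph.adj G) μ)
        V-[]S𝕄 (yes PG) = V-resp _ _ (λ μ → sym ([]-true _ ≡.refl)) (V-S𝕄′ (suc (Graph.m G)) (Graph.adj G) (Graph.noIso G) PG)
        V-[]S𝕄 (no _)   = V-resp _ _ (λ μ → sym ([]-false _ ≡.refl)) V-0

  module SpanIntersection (𝒞 𝒟 : GraphClass) where
    private
      module C = SpanOfClass 𝒞
      module D = SpanOfClass 𝒟
      open ClassOfGraphs (𝒞 ∩ᶜ 𝒟)

      V : Series → Set (c ⊔ ℓ)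
      V x = C.V x × D.V x

      coefficient-outside : ∀ x r → x ≈ₛ eval r → V x → ∀ G → ¬ GraphClass.Holds (𝒞 ∩ᶜ 𝒟) (Graph.adj G) → coefficient r G ≈ 0#
      coefficient-outside x r x≈r (v₁ , v₂) G ¬both with GraphClass.holds? 𝒞 (Graph.adj G) | GraphClass.holds? 𝒟 (Graph.adj G)
      ... | no ¬c | _     = C.coefficient-outside x r x≈r v₁ G ¬c
      ... | yes c | no ¬d = D.coefficient-outside x r x≈r v₂ G ¬d
      ... | yes c | yes d = ⊥-elim (¬both (c , d))

    hopfSubalgebra : IsHopfSubalgebra V
    hopfSubalgebra = record
      { sub      = λ x v → IsHopfSubalgebra.sub C.hopfSubalgebra x (proj₁ v)
      ; resp     = λ x y x≈y (v₁ , v₂) → C.V-resp x y x≈y v₁ , D.V-resp x y x≈y v₂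
      ; zero∈    = C.V-0 , D.V-0
      ; +-closed = λ x y (u₁ , u₂) (v₁ , v₂) → C.V-+ x y u₁ v₁ , D.V-+ x y u₂ v₂
      ; ·-closed = λ a x (v₁ , v₂) → C.V-· a x v₁ , D.V-· a x v₂
      ; one∈     = C.V-1 , D.V-1
      ; *-closed = λ x y (u₁ , u₂) (v₁ , v₂) → C.V-* x y u₁ v₁ , D.V-* x y u₂ v₂
      ; Δ-closed = λ x r x≈r v → Δ-in-span V (λ G (c , d) → C.V-𝕄 G c , D.V-𝕄 G d) r (coefficient-outside x r x≈r v)
      ; S-closed = λ x r x≈r (v₁ , v₂) → IsHopfSubalgebra.S-closed C.hopfSubalgebra x r x≈r v₁ ,
                                          IsHopfSubalgebra.S-closed D.hopfSubalgebra x r x≈r v₂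
      }

mainTheorem3 : ∀ {c ℓ} (F : Field c ℓ) → CharZero F →
    let open GQSym F in
    IsHopfSubalgebra GQSym011 × IsHopfSubalgebra GQSym101 × IsHopfSubalgebra GQSym001
mainTheorem3 F _ =
  SpanOfClass.hopfSubalgebra symmetricGraphs ,
  SpanOfClass.hopfSubalgebra zeroDiagonalGraphs ,
  SpanIntersection.hopfSubalgebra symmetricGraphs zeroDiagonalGraphs
  where open Series F
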